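{- Let $n\ge6$ and let $P$ be a monotone weakly separated path of $3$-subsets of $[n]$ from $\{1,2,3\}$ to $\{n-2,n-1,n\}$. Write $[1,n]=L_0\cup H_1\cup L_1\cup H_2\cup\cdots\cup H_m\cup L_m$ ($m\ge0$), where $L_0=[1,\ell_0]$, $H_1=[\ell_0,h_1]$, $L_1=[h_1,\ell_1]$, $\dots$, $H_m=[\ell_{m-1},h_m]$, $L_m=[h_m,n]$ with $1<\ell_0<h_1<\ell_1<\cdots<h_m<n$ integers when $m\ge1$ (and $L_0=[1,n]$ when $m=0$), such that every unit interval $[j,j+1]$ contained in some $L_i$ satisfies $\operatorname{wt}([j,j+1])\le\operatorname{wtlim}([j,j+1])$ and every unit interval contained in some $H_i$ satisfies $\operatorname{wt}([j,j+1])>\operatorname{wtlim}([j,j+1])$. Then, with $\mu$ denoting length: (a) $\mu(L_0)\ge2$; (b) $\mu(L_m)\ge2$; (c) $\mu(L_i)\ge3$ for $1\le i\le m-1$; (d) $\mu(H_i)\le4$ for $1\le i\le m$.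
   Context: A monotone weakly separated path is a sequence $(A_0,\dots,A_N)$ of $k$-subsets which are pairwise weakly separated (different $I,J$ are weakly separated if $\max(I\setminus J)<\min(J\setminus I)$ or $\max(J\setminus I)<\min(I\setminus J)$), with $A_i\setminus A_{i-1}=\{x_i\}$, $A_{i-1}\setminus A_i=\{y_i\}$, $x_i>y_i$. The arc diagram $\mathbf{D}(P)$ is the simple graph on $[n]$ whose edges are the pairs $(A_{a-1}\setminus A_a)\cup(A_a\setminus A_{a-1})$, $a\in[N]$. Each edge $\{p,q\}$ ($p<q$) has weight $1$, spread uniformly over $[p,q]$: it contributes $1/(q-p)$ to each unit interval $[j,j+1]$ with $p\le j<q$; $\operatorname{wt}([j,j+1])$ is the sum of these contributions over all edges. The weight limit is $\operatorname{wtlim}([1,2])=\operatorname{wtlim}([n-1,n])=1$, $\operatorname{wtlim}([2,3])=\operatorname{wtlim}([n-2,n-1])=3/2$, and $\operatorname{wtlim}([j,j+1])=11/6$ for $3\le j\le n-3$. -}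

module Defs where

open import Data.Nat using (ℕ; zero; suc; _≤_; _<_; _∸_; _≡ᵇ_)
open import Data.Bool using (Bool; true; false; _∧_; _∨_; if_then_else_)
open import Data.Integer using (+_)
open import Data.Rational using (ℚ; 0ℚ; 1ℚ; _/_; _+_)
open import Data.List using (List; map; upTo)
open import Data.Bool.ListAction using (any)
open import Data.Product using (_×_; Σ)
open import Data.Sum using (_⊎_)
open import Relation.Binary.PropositionalEquality using (_≡_; _≢_)
open import Function.Bundles using (_⇔_)

Sub : Set
Sub = ℕ → Bool

_∈ˢ_ : ℕ → Sub → Set
x ∈ˢ A = A x ≡ true

_∉ˢ_ : ℕ → Sub → Set
x ∉ˢ A = A x ≡ false

card : Sub → ℕ → ℕ
card A zero = zero
card A (suc m) = Data.Nat._+_ (card A m) (if A (suc m) then 1 else 0)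

IsKSubset : ℕ → ℕ → Sub → Set
IsKSubset n k A = (∀ x → x ∈ˢ A → 1 ≤ x × x ≤ n) × card A n ≡ k

⟦_,_,_⟧ : ℕ → ℕ → ℕ → Sub
⟦ a , b , c ⟧ z = (z ≡ᵇ a) ∨ (z ≡ᵇ b) ∨ (z ≡ᵇ c)

WeaklySeparated : Sub → Sub → Set
WeaklySeparated I J =
  (∀ u v → u ∈ˢ I → u ∉ˢ J → v ∈ˢ J → v ∉ˢ I → u < v)
  ⊎ (∀ u v → u ∈ˢ I → u ∉ˢ J → v ∈ˢ J → v ∉ˢ I → v < u)

record MonotoneWSPath (n k : ℕ) : Set where
  field
    N     : ℕ
    A     : ℕ → Sub
    x y   : ℕ → ℕ
    ksub  : ∀ i → i ≤ N → IsKSubset n k (A i)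
    wsep  : ∀ i j → i ≤ N → j ≤ N → WeaklySeparated (A i) (A j)
    stepx : ∀ a → 1 ≤ a → a ≤ N →
              ∀ z → ((z ∈ˢ A a) × (z ∉ˢ A (a ∸ 1))) ⇔ (z ≡ x a)
    stepy : ∀ a → 1 ≤ a → a ≤ N →
              ∀ z → ((z ∈ˢ A (a ∸ 1)) × (z ∉ˢ A a)) ⇔ (z ≡ y a)
    mono  : ∀ a → 1 ≤ a → a ≤ N → y a < x a

open MonotoneWSPath public

range1 : ℕ → List ℕ
range1 N = map suc (upTo N)

isEdge : ∀ {n k} → MonotoneWSPath n k → ℕ → ℕ → Bool
isEdge P p q = any (λ a → (y P a ≡ᵇ p) ∧ (x P a ≡ᵇ q)) (range1 (N P))

-- 1/d as a rational (d > 0 in all uses)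
inv : ℕ → ℚ
inv zero = 0ℚ
inv (suc d) = + 1 / suc d

sumTo : ℕ → (ℕ → ℚ) → ℚ
sumTo zero f = 0ℚ
sumTo (suc m) f = sumTo m f + f (suc m)

-- wt([j,j+1]): each edge {p,q} (p<q) of D(P) contributes 1/(q-p)
-- when p ≤ j < q.  Edges are summed as a set (each distinct edge once).
wt : ∀ {n k} → MonotoneWSPath n k → ℕ → ℚ
wt {n} P j = sumTo n (λ p → sumTo n (λ q →
  if isEdge P p q ∧ (p Data.Nat.≤ᵇ j) ∧ (suc j Data.Nat.≤ᵇ q)
  then inv (q ∸ p) else 0ℚ))

wtlim : ℕ → ℕ → ℚ
wtlim n j =
  if (j ≡ᵇ 1) ∨ (j ≡ᵇ n ∸ 1) then 1ℚ
  else if (j ≡ᵇ 2) ∨ (j ≡ᵇ n ∸ 2) then + 3 / 2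
  else + 11 / 6

-- Decomposition [1,n] = L_0 ∪ H_1 ∪ L_1 ∪ … ∪ H_m ∪ L_m given by
-- ℓ 0,…,ℓ (m-1) and h 1,…,h m.
-- L_i = [Lstart i, Lend i],  H_i = [ℓ (i-1), h i].
Lstart : ℕ → (ℕ → ℕ) → ℕ → ℕ
Lstart m h zero = 1
Lstart m h (suc i) = h (suc i)

Lend : ℕ → ℕ → (ℕ → ℕ) → ℕ → ℕ
Lend n m ℓ i = if i ≡ᵇ m then n else ℓ i

module Submission where

-- For a unit interval [v, v+1] consider the steps of P whose edge {y, x} spans it (y ≤ v < x).
-- Each of them lowers |A_t ∩ [1, v]| by one, so there are |A_0 ∩ [1, v]| − |A_N ∩ [1, v]| of them:
-- 1, 2, 3, …, 3, 2, 1 along [1, n]. As wt([v, v+1]) is at most the sum of 1/length over their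
-- distinct edges, a heavy interval lies in [3, n−3] and its three crossing edges are the distinct
-- short edges {v−1, v+1}, {v, v+1}, {v, v+2}; a light interval cannot carry all three of them
-- (1/2 + 1 + 1/2 > 11/6). This gives (a) and (b).
-- For (c) and (d), watch the path through a window of at most seven positions: the counts
-- |A_t ∩ [1, w₀ + j]| form a profile that each step lowers by one on an interval, that stays
-- 1-Lipschitz, and whose differences between two times never dip, by weak separation. An exhaustive
-- search over such walks shows that none realises five consecutive heavy intervals, or two heavy
-- intervals separated by one or two light ones.

open import Defs
open import Data.Nat using (ℕ; zero; suc; _+_; _∸_; _⊓_; _≤_; _<_; _≤ᵇ_; _<ᵇ_; _≡ᵇ_; z≤n; s≤s)
open import Data.Nat.Properties
open import Data.Bool.Properties using (T-∧)
open import Data.Bool using (Bool; true; false; _∧_; _∨_; not; if_then_else_; T)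
open import Data.List using (List; []; _∷_; length; zipWith; upTo; applyUpTo)
open import Data.Nat.ListAction using (sum)
open import Data.Bool.ListAction using (all; any)
import Data.List.Properties as List
open import Data.List.Relation.Unary.All using (All; []; _∷_; lookup)
import Data.List.Relation.Unary.All as All
open import Data.List.Relation.Unary.All.Properties using (all⁻)
open import Data.List.Relation.Unary.Any using (Any; here; there)
open import Data.List.Relation.Unary.Any.Properties using (any⁺; any⁻; map⁺; map⁻; applyUpTo⁺; applyUpTo⁻)
open import Data.Product using (_×_; _,_; proj₁; proj₂; ∃-syntax; uncurry)
open import Data.Product.Properties using (≡-dec)
open import Data.Sum using (_⊎_; inj₁; inj₂; [_,_]′)
open import Data.Empty using (⊥; ⊥-elim)
open import Relation.Nullary using (¬_; Dec; yes; no; ⌊_⌋; _×-dec_; _⊎-dec_)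
open import Relation.Nullary.Decidable using (toWitness; fromWitness)
open import Relation.Binary.PropositionalEquality
  using (_≡_; _≢_; refl; sym; trans; cong; cong₂; subst; subst₂; module ≡-Reasoning)
open import Function using (_∘_)
open import Function.Bundles using (Equivalence)
import Data.Integer as ℤ
import Data.Integer.Properties as ℤ
open import Data.Rational using (ℚ; 0ℚ; 1ℚ; _/_; ↥_; ↧_; *≤*)
  renaming (_≤_ to _≤ℚ_; _<_ to _<ℚ_; _+_ to _+ℚ_)
import Data.Rational.Properties as ℚ
open import Algebra.Bundles using (CommutativeMonoid)
open import Algebra.Properties.CommutativeSemigroup
  (CommutativeMonoid.commutativeSemigroup ℚ.+-0-commutativeMonoid) using () renaming (interchange to +ℚ-interchange)
import Data.Nat.GCD as ℕ

T⇒≡true : ∀ {b} → T b → b ≡ true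
T⇒≡true {true} _ = refl

≡true⇒T : ∀ {b} → b ≡ true → T b
≡true⇒T refl = _

¬T⇒≡false : ∀ {b} → ¬ T b → b ≡ false
¬T⇒≡false {true}  ¬t = ⊥-elim (¬t _)
¬T⇒≡false {false} _  = refl

≤⇒≤ᵇ≡true : ∀ {m n} → m ≤ n → (m ≤ᵇ n) ≡ true
≤⇒≤ᵇ≡true m≤n = T⇒≡true (≤⇒≤ᵇ m≤n)

≰⇒≤ᵇ≡false : ∀ {m n} → ¬ m ≤ n → (m ≤ᵇ n) ≡ false
≰⇒≤ᵇ≡false {m} {n} m≰n = ¬T⇒≡false (λ t → m≰n (≤ᵇ⇒≤ m n t))

≤ᵇ≡true⇒≤ : ∀ {m n} → (m ≤ᵇ n) ≡ true → m ≤ n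
≤ᵇ≡true⇒≤ {m} {n} e = ≤ᵇ⇒≤ m n (≡true⇒T e)

<⇒<ᵇ≡true : ∀ {m n} → m < n → (m <ᵇ n) ≡ true
<⇒<ᵇ≡true m<n = T⇒≡true (<⇒<ᵇ m<n)

≮⇒<ᵇ≡false : ∀ {m n} → ¬ m < n → (m <ᵇ n) ≡ false
≮⇒<ᵇ≡false {m} {n} m≮n = ¬T⇒≡false (λ t → m≮n (<ᵇ⇒< m n t))

<ᵇ≡true⇒< : ∀ {m n} → (m <ᵇ n) ≡ true → m < n
<ᵇ≡true⇒< {m} {n} e = <ᵇ⇒< m n (≡true⇒T e)

≡⇒≡ᵇ≡true : ∀ {m n} → m ≡ n → (m ≡ᵇ n) ≡ true
≡⇒≡ᵇ≡true {m} {n} m≡n = T⇒≡true (≡⇒≡ᵇ m n m≡n)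

≢⇒≡ᵇ≡false : ∀ {m n} → m ≢ n → (m ≡ᵇ n) ≡ false
≢⇒≡ᵇ≡false {m} {n} m≢n = ¬T⇒≡false (λ t → m≢n (≡ᵇ⇒≡ m n t))

≡ᵇ≡true⇒≡ : ∀ {m n} → (m ≡ᵇ n) ≡ true → m ≡ n
≡ᵇ≡true⇒≡ {m} {n} e = ≡ᵇ⇒≡ m n (≡true⇒T e)

∧-intro : ∀ {a b} → a ≡ true → b ≡ true → (a ∧ b) ≡ true
∧-intro refl refl = refl

∧-elimˡ : ∀ {a b} → (a ∧ b) ≡ true → a ≡ true
∧-elimˡ {true} _ = refl

∧-elimʳ : ∀ {a b} → (a ∧ b) ≡ true → b ≡ true
∧-elimʳ {true} e = e

∨-introˡ : ∀ {a b} → a ≡ true → (a ∨ b) ≡ true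
∨-introˡ refl = refl

∨-introʳ : ∀ {a b} → b ≡ true → (a ∨ b) ≡ true
∨-introʳ {true}  _ = refl
∨-introʳ {false} e = e

toℕ : Bool → ℕ
toℕ b = if b then 1 else 0

card-cong : ∀ {S T : Sub} → (∀ z → S z ≡ T z) → ∀ v → card S v ≡ card T v
card-cong S≗T zero = refl
card-cong S≗T (suc v) rewrite S≗T (suc v) | card-cong S≗T v = refl

card-≤-suc : ∀ (S : Sub) v → card S v ≤ card S (suc v) × card S (suc v) ≤ suc (card S v)
card-≤-suc S v with S (suc v)
... | true  = m≤m+n _ 1 , ≤-reflexive (+-comm (card S v) 1)
... | false = m≤m+n _ 0 , ≤-trans (≤-reflexive (+-identityʳ _)) (n≤1+n _)

private
  widen : ∀ {S T : Sub} {a b} → ∃[ u ] (a < u × u ≤ b × T u ≡ true × S u ≡ false) →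
          ∃[ u ] (a < u × u ≤ suc b × T u ≡ true × S u ≡ false)
  widen (u , a<u , u≤b , Tu , Su) = u , a<u , m≤n⇒m≤1+n u≤b , Tu , Su

-- The hypothesis says that T has more elements than S in (a, b].
card-surplus⇒∈∖ : ∀ (S T : Sub) a b → a ≤ b → card S b + card T a < card T b + card S a →
                  ∃[ u ] (a < u × u ≤ b × T u ≡ true × S u ≡ false)
card-surplus⇒∈∖ S T a zero z≤n surplus = ⊥-elim (<-irrefl (+-comm (card S 0) (card T 0)) surplus)
card-surplus⇒∈∖ S T a (suc b) a≤1+b surplus with a ≟ suc b
... | yes refl = ⊥-elim (<-irrefl (+-comm (card S (suc b)) (card T (suc b))) surplus)
... | no a≢1+b with T (suc b) in Tb | S (suc b) in Sb
...   | true  | false = suc b , ≤∧≢⇒< a≤1+b a≢1+b , ≤-refl , Tb , Sb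
...   | true  | true  = widen (card-surplus⇒∈∖ S T a b (≤-pred (≤∧≢⇒< a≤1+b a≢1+b))
                          (cancel (card S b) (card T a) (card T b) (card S a) surplus))
  where
  cancel : ∀ p q r s → p + 1 + q < r + 1 + s → p + q < r + s
  cancel p q r s lt rewrite +-assoc p 1 q | +-assoc r 1 s | +-comm 1 q | +-comm 1 s
    | sym (+-assoc p q 1) | sym (+-assoc r s 1) = +-cancelʳ-< _ _ _ lt
...   | false | true  = widen (card-surplus⇒∈∖ S T a b (≤-pred (≤∧≢⇒< a≤1+b a≢1+b))
                          (≤-<-trans (+-monoˡ-≤ (card T a) (m≤m+n (card S b) 1))
                            (<-≤-trans surplus (≤-reflexive (cong (_+ card S a) (+-identityʳ (card T b)))))))
...   | false | false = widen (card-surplus⇒∈∖ S T a b (≤-pred (≤∧≢⇒< a≤1+b a≢1+b))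
                          (subst₂ _<_ (cong (_+ card T a) (+-identityʳ (card S b)))
                                      (cong (_+ card S a) (+-identityʳ (card T b))) surplus))

lastThree : ℕ → Sub
lastThree m = ⟦ suc m , suc (suc m) , suc (suc (suc m)) ⟧

card-⟦1,2,3⟧ : ∀ {v} → 3 ≤ v → card ⟦ 1 , 2 , 3 ⟧ v ≡ 3
card-⟦1,2,3⟧ 3≤v with m≤n⇒∃[o]m+o≡n 3≤v
... | k , refl = go k
  where
  go : ∀ k → card ⟦ 1 , 2 , 3 ⟧ (3 + k) ≡ 3
  go zero    = refl
  go (suc k) = trans (+-identityʳ _) (go k)

card-lastThree-≤ : ∀ m v → v ≤ m → card (lastThree m) v ≡ 0
card-lastThree-≤ m zero    _   = refl
card-lastThree-≤ m (suc v) 1+v≤m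
  rewrite ≢⇒≡ᵇ≡false {v} {m} (<⇒≢ 1+v≤m)
        | ≢⇒≡ᵇ≡false {v} {suc m} (<⇒≢ (m≤n⇒m≤1+n 1+v≤m))
        | ≢⇒≡ᵇ≡false {v} {suc (suc m)} (<⇒≢ (m≤n⇒m≤1+n (m≤n⇒m≤1+n 1+v≤m)))
  = trans (+-identityʳ _) (card-lastThree-≤ m v (<⇒≤ 1+v≤m))

card-lastThree-1+m : ∀ m → card (lastThree m) (suc m) ≡ 1
card-lastThree-1+m m rewrite ≡⇒≡ᵇ≡true {m} refl | card-lastThree-≤ m m ≤-refl = refl

card-lastThree-2+m : ∀ m → card (lastThree m) (suc (suc m)) ≡ 2
card-lastThree-2+m m rewrite ≢⇒≡ᵇ≡false {suc m} {m} (λ e → 1+n≢n e) | ≡⇒≡ᵇ≡true {m} refl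
                          | card-lastThree-≤ m m ≤-refl = refl

-- Crossings of a monotone path

module Crossings {n k : ℕ} (P : MonotoneWSPath n k) where

  crosses : ℕ → ℕ → Bool
  crosses a v = (y P a ≤ᵇ v) ∧ (v <ᵇ x P a)

  crosses-intro : ∀ {a v} → y P a ≤ v → v < x P a → crosses a v ≡ true
  crosses-intro y≤v v<x = ∧-intro (≤⇒≤ᵇ≡true y≤v) (<⇒<ᵇ≡true v<x)

  crosses⇒y≤ : ∀ {a v} → crosses a v ≡ true → y P a ≤ v
  crosses⇒y≤ c = ≤ᵇ≡true⇒≤ (∧-elimˡ c)

  crosses⇒<x : ∀ {a v} → crosses a v ≡ true → v < x P a
  crosses⇒<x {a} {v} c = <ᵇ≡true⇒< (∧-elimʳ {y P a ≤ᵇ v} c)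

  x-enters : ∀ a → 1 ≤ a → a ≤ N P → A P a (x P a) ≡ true × A P (a ∸ 1) (x P a) ≡ false
  x-enters a 1≤a a≤N = Equivalence.from (stepx P a 1≤a a≤N (x P a)) refl

  y-leaves : ∀ a → 1 ≤ a → a ≤ N P → A P (a ∸ 1) (y P a) ≡ true × A P a (y P a) ≡ false
  y-leaves a 1≤a a≤N = Equivalence.from (stepy P a 1≤a a≤N (y P a)) refl

  others-stay : ∀ a → 1 ≤ a → a ≤ N P → ∀ z → z ≢ x P a → z ≢ y P a → A P a z ≡ A P (a ∸ 1) z
  others-stay a 1≤a a≤N z z≢x z≢y with A P a z in Az | A P (a ∸ 1) z in A'z
  ... | true  | true  = refl
  ... | false | false = refl
  ... | true  | false = ⊥-elim (z≢x (Equivalence.to (stepx P a 1≤a a≤N z) (Az , A'z)))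
  ... | false | true  = ⊥-elim (z≢y (Equivalence.to (stepy P a 1≤a a≤N z) (A'z , Az)))

  1≤y : ∀ a → 1 ≤ a → a ≤ N P → 1 ≤ y P a
  1≤y a 1≤a a≤N = proj₁ (proj₁ (ksub P (a ∸ 1) (≤-trans (m∸n≤m a 1) a≤N)) (y P a) (proj₁ (y-leaves a 1≤a a≤N)))

  x≤n : ∀ a → 1 ≤ a → a ≤ N P → x P a ≤ n
  x≤n a 1≤a a≤N = proj₂ (proj₁ (ksub P a a≤N) (x P a) (proj₁ (x-enters a 1≤a a≤N)))

  crosses-shift : ∀ a → 1 ≤ a → a ≤ N P → ∀ v →
    toℕ (crosses a v) + toℕ (A P (a ∸ 1) (suc v)) ≡ toℕ (A P a (suc v)) + toℕ (crosses a (suc v))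
  crosses-shift a 1≤a a≤N v with suc v ≟ y P a | suc v ≟ x P a
  ... | yes 1+v≡y | _
    rewrite subst (λ z → A P (a ∸ 1) z ≡ true) (sym 1+v≡y) (proj₁ (y-leaves a 1≤a a≤N))
          | subst (λ z → A P a z ≡ false) (sym 1+v≡y) (proj₂ (y-leaves a 1≤a a≤N))
          | ≰⇒≤ᵇ≡false {y P a} {v} (λ y≤v → 1+n≰n (≤-trans (≤-reflexive 1+v≡y) y≤v))
          | ≤⇒≤ᵇ≡true {y P a} {suc v} (≤-reflexive (sym 1+v≡y))
          | <⇒<ᵇ≡true {suc v} {x P a} (subst (_< x P a) (sym 1+v≡y) (mono P a 1≤a a≤N)) = refl
  ... | no _ | yes 1+v≡x
    rewrite subst (λ z → A P (a ∸ 1) z ≡ false) (sym 1+v≡x) (proj₂ (x-enters a 1≤a a≤N))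
          | subst (λ z → A P a z ≡ true) (sym 1+v≡x) (proj₁ (x-enters a 1≤a a≤N))
          | ≤⇒≤ᵇ≡true {y P a} {v} (≤-pred (subst (y P a <_) (sym 1+v≡x) (mono P a 1≤a a≤N)))
          | ≤⇒≤ᵇ≡true {y P a} {suc v} (m≤n⇒m≤1+n (≤-pred (subst (y P a <_) (sym 1+v≡x) (mono P a 1≤a a≤N))))
          | <⇒<ᵇ≡true {v} {x P a} (≤-reflexive 1+v≡x)
          | ≮⇒<ᵇ≡false {suc v} {x P a} (λ 1+v<x → <-irrefl 1+v≡x 1+v<x) = refl
  ... | no 1+v≢y | no 1+v≢x rewrite others-stay a 1≤a a≤N (suc v) 1+v≢x 1+v≢y =
    trans (cong (_+ toℕ (A P (a ∸ 1) (suc v))) same) (+-comm (toℕ (crosses a (suc v))) _)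
    where
    same-y : (y P a ≤ᵇ v) ≡ (y P a ≤ᵇ suc v)
    same-y with y P a ≤? v
    ... | yes y≤v rewrite ≤⇒≤ᵇ≡true y≤v | ≤⇒≤ᵇ≡true (m≤n⇒m≤1+n y≤v) = refl
    ... | no y≰v rewrite ≰⇒≤ᵇ≡false y≰v
                       | ≰⇒≤ᵇ≡false {y P a} {suc v} (λ y≤1+v → y≰v (≤-pred (≤∧≢⇒< y≤1+v (1+v≢y ∘ sym))))
                       = refl
    same-x : (v <ᵇ x P a) ≡ (suc v <ᵇ x P a)
    same-x with suc v <? x P a
    ... | yes 1+v<x rewrite <⇒<ᵇ≡true 1+v<x | <⇒<ᵇ≡true {v} {x P a} (<-trans ≤-refl 1+v<x) = refl
    ... | no 1+v≮x rewrite ≮⇒<ᵇ≡false 1+v≮x | ≮⇒<ᵇ≡false {v} {x P a} (λ v<x → 1+v≮x (≤∧≢⇒< v<x 1+v≢x)) = refl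
    same : toℕ (crosses a v) ≡ toℕ (crosses a (suc v))
    same rewrite same-y | same-x = refl

  card-step : ∀ a → 1 ≤ a → a ≤ N P → ∀ v → card (A P (a ∸ 1)) v ≡ card (A P a) v + toℕ (crosses a v)
  card-step a 1≤a a≤N zero rewrite ≰⇒≤ᵇ≡false {y P a} {0} (<⇒≱ (1≤y a 1≤a a≤N)) = refl
  card-step a 1≤a a≤N (suc v) = begin
    card A′ v + toℕ (A′ (suc v))                    ≡⟨ cong (_+ toℕ (A′ (suc v))) (card-step a 1≤a a≤N v) ⟩
    card B v + toℕ (crosses a v) + toℕ (A′ (suc v))  ≡⟨ +-assoc (card B v) _ _ ⟩
    card B v + (toℕ (crosses a v) + toℕ (A′ (suc v))) ≡⟨ cong (card B v +_) (crosses-shift a 1≤a a≤N v) ⟩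
    card B v + (toℕ (B (suc v)) + toℕ (crosses a (suc v))) ≡⟨ +-assoc (card B v) _ _ ⟨
    card B v + toℕ (B (suc v)) + toℕ (crosses a (suc v)) ∎
    where
    open ≡-Reasoning
    A′ = A P (a ∸ 1)
    B = A P a

  card-antitone : ∀ {s t} v → s ≤ t → t ≤ N P → card (A P t) v ≤ card (A P s) v
  card-antitone {s} v s≤t t≤N with m≤n⇒∃[o]m+o≡n s≤t
  ... | j , refl = go j t≤N
    where
    go : ∀ j → s + j ≤ N P → card (A P (s + j)) v ≤ card (A P s) v
    go zero    _ rewrite +-identityʳ s = ≤-refl
    go (suc j) 1+s+j≤N rewrite +-suc s j =
      ≤-trans (≤-trans (m≤m+n _ _) (≤-reflexive (sym (card-step (suc (s + j)) (s≤s z≤n) 1+s+j≤N v))))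
              (go j (<⇒≤ 1+s+j≤N))

  gap : ℕ → ℕ → ℕ → ℕ
  gap s t v = card (A P s) v ∸ card (A P t) v

  -- Where the gap falls, A t gains on A s, and where it rises A s gains on A t;
  -- a fall between two rises (the first one from 0) would violate weak separation.
  gap-no-dip : ∀ {s t} → s ≤ t → t ≤ N P → ∀ {v₁ v₂ v₃} → v₁ < v₂ → v₂ < v₃ →
               ¬ (gap s t v₂ < gap s t v₁ × gap s t v₂ < gap s t v₃)
  gap-no-dip {s} {t} s≤t t≤N {v₁} {v₂} {v₃} v₁<v₂ v₂<v₃ (fall , rise) =
    separate (wsep P s t (≤-trans s≤t t≤N) t≤N)
      (card-surplus⇒∈∖ I J v₁ v₂ (<⇒≤ v₁<v₂)
        (subst (card I v₂ + card J v₁ <_) (+-comm (card I v₁) (card J v₂)) fall′))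
      (card-surplus⇒∈∖ J I v₂ v₃ (<⇒≤ v₂<v₃)
        (subst (_< card I v₃ + card J v₂) (+-comm (card I v₂) (card J v₃)) rise′))
      (card-surplus⇒∈∖ J I 0 v₁ z≤n initial)
    where
    I = A P s
    J = A P t
    ∸<∸⇒+<+ : ∀ {p p′ q q′} → p′ ≤ p → q′ ≤ q → q ∸ q′ < p ∸ p′ → q + p′ < p + q′
    ∸<∸⇒+<+ {p} {p′} {q} {q′} p′≤p q′≤q lt = subst₂ _<_
      (trans (sym (+-assoc (q ∸ q′) q′ p′)) (cong (_+ p′) (m∸n+n≡m q′≤q)))
      (trans (cong (p ∸ p′ +_) (+-comm q′ p′)) (trans (sym (+-assoc (p ∸ p′) p′ q′)) (cong (_+ q′) (m∸n+n≡m p′≤p))))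
      (+-monoˡ-< (q′ + p′) lt)
    fall′ : card I v₂ + card J v₁ < card I v₁ + card J v₂
    fall′ = ∸<∸⇒+<+ (card-antitone v₁ s≤t t≤N) (card-antitone v₂ s≤t t≤N) fall
    rise′ : card I v₂ + card J v₃ < card I v₃ + card J v₂
    rise′ = ∸<∸⇒+<+ (card-antitone v₃ s≤t t≤N) (card-antitone v₂ s≤t t≤N) rise
    initial : card J v₁ + 0 < card I v₁ + 0
    initial = subst₂ _<_ (sym (+-identityʳ (card J v₁))) (sym (+-identityʳ (card I v₁)))
      (+-cancelʳ-< (card I v₂) (card J v₁) (card I v₁)
        (<-≤-trans (subst (_< card I v₁ + card J v₂) (+-comm (card I v₂) (card J v₁)) fall′)
                   (+-monoʳ-≤ (card I v₁) (card-antitone v₂ s≤t t≤N))))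
    separate : WeaklySeparated I J →
               ∃[ u ] (v₁ < u × u ≤ v₂ × J u ≡ true × I u ≡ false) →
               ∃[ w ] (v₂ < w × w ≤ v₃ × I w ≡ true × J w ≡ false) →
               ∃[ w ] (0 < w × w ≤ v₁ × I w ≡ true × J w ≡ false) → ⊥
    separate (inj₁ I∖J<J∖I) (u , _ , u≤v₂ , Ju , Iu) (w , v₂<w , _ , Iw , Jw) _ =
      <-irrefl refl (<-trans (I∖J<J∖I w u Iw Jw Ju Iu) (≤-<-trans u≤v₂ v₂<w))
    separate (inj₂ J∖I<I∖J) (u , v₁<u , _ , Ju , Iu) _ (w , _ , w≤v₁ , Iw , Jw) =
      <-irrefl refl (<-trans (J∖I<I∖J w u Iw Jw Ju Iu) (≤-<-trans w≤v₁ v₁<u))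

  crossingSteps : ℕ → ℕ → List ℕ
  crossingSteps v zero    = []
  crossingSteps v (suc t) = if crosses (suc t) v then suc t ∷ crossingSteps v t else crossingSteps v t

  length-crossingSteps : ∀ v t → t ≤ N P → length (crossingSteps v t) + card (A P t) v ≡ card (A P 0) v
  length-crossingSteps v zero    _     = refl
  length-crossingSteps v (suc t) 1+t≤N with crosses (suc t) v in c
  ... | true  = begin
    suc (length (crossingSteps v t) + card (A P (suc t)) v) ≡⟨ +-suc _ _ ⟨
    length (crossingSteps v t) + suc (card (A P (suc t)) v)  ≡⟨ cong (length (crossingSteps v t) +_) step ⟨
    length (crossingSteps v t) + card (A P t) v             ≡⟨ length-crossingSteps v t (<⇒≤ 1+t≤N) ⟩
    card (A P 0) v ∎
    where
    open ≡-Reasoning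
    step : card (A P t) v ≡ suc (card (A P (suc t)) v)
    step = trans (card-step (suc t) (s≤s z≤n) 1+t≤N v) (trans (cong (λ b → card (A P (suc t)) v + toℕ b) c) (+-comm _ 1))
  ... | false = trans (cong (length (crossingSteps v t) +_) step) (length-crossingSteps v t (<⇒≤ 1+t≤N))
    where
    step : card (A P (suc t)) v ≡ card (A P t) v
    step = sym (trans (card-step (suc t) (s≤s z≤n) 1+t≤N v)
                      (trans (cong (λ b → card (A P (suc t)) v + toℕ b) c) (+-identityʳ _)))

  ∈-crossingSteps⁻ : ∀ {v t a} → Any (a ≡_) (crossingSteps v t) → 1 ≤ a × a ≤ t × crosses a v ≡ true
  ∈-crossingSteps⁻ {v} {suc t} a∈ with crosses (suc t) v in c
  ∈-crossingSteps⁻ {v} {suc t} (here refl) | true = s≤s z≤n , ≤-refl , c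
  ∈-crossingSteps⁻ {v} {suc t} (there a∈)  | true with ∈-crossingSteps⁻ a∈
  ... | 1≤a , a≤t , ca = 1≤a , m≤n⇒m≤1+n a≤t , ca
  ∈-crossingSteps⁻ {v} {suc t} a∈ | false with ∈-crossingSteps⁻ a∈
  ... | 1≤a , a≤t , ca = 1≤a , m≤n⇒m≤1+n a≤t , ca

  ∈-crossingSteps⁺ : ∀ {v t a} → 1 ≤ a → a ≤ t → crosses a v ≡ true → Any (a ≡_) (crossingSteps v t)
  ∈-crossingSteps⁺ {v} {zero}  1≤a a≤0 _ = ⊥-elim (<⇒≱ 1≤a a≤0)
  ∈-crossingSteps⁺ {v} {suc t} {a} 1≤a a≤1+t ca with a ≟ suc t
  ... | yes refl rewrite ca = here refl
  ... | no a≢1+t with crosses (suc t) v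
  ...   | true  = there (∈-crossingSteps⁺ 1≤a (≤-pred (≤∧≢⇒< a≤1+t a≢1+t)) ca)
  ...   | false = ∈-crossingSteps⁺ 1≤a (≤-pred (≤∧≢⇒< a≤1+t a≢1+t)) ca

<⇒≱ℚ : ∀ {p q} → p <ℚ q → ¬ q ≤ℚ p
<⇒≱ℚ p<q q≤p = ℚ.<-irrefl refl (ℚ.<-≤-trans p<q q≤p)

0≤inv : ∀ d → 0ℚ ≤ℚ inv d
0≤inv zero    = ℚ.≤-refl
0≤inv (suc d) = ℚ.nonNegative⁻¹ (inv (suc d)) {{ℚ.normalize-nonNeg 1 (suc d)}}

private
  ↥inv : ∀ d → ↥ (inv (suc d)) ≡ ℤ.+ 1
  ↥inv d = trans (sym (ℤ.*-identityʳ _))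
                 (trans (cong (λ g → ↥ (inv (suc d)) ℤ.* ℤ.+ g) (sym (ℕ.gcd-zeroˡ (suc d)))) (ℚ.↥-/ (ℤ.+ 1) (suc d)))

  ↧inv : ∀ d → ↧ (inv (suc d)) ≡ ℤ.+ suc d
  ↧inv d = trans (sym (ℤ.*-identityʳ _))
                 (trans (cong (λ g → ↧ (inv (suc d)) ℤ.* ℤ.+ g) (sym (ℕ.gcd-zeroˡ (suc d)))) (ℚ.↧-/ (ℤ.+ 1) (suc d)))

inv-antitone : ∀ {d e} → e ≤ d → inv (suc d) ≤ℚ inv (suc e)
inv-antitone {d} {e} e≤d = *≤* (subst₂ ℤ._≤_
  (sym (trans (cong₂ ℤ._*_ (↥inv d) (↧inv e)) (ℤ.*-identityˡ _)))
  (sym (trans (cong₂ ℤ._*_ (↥inv e) (↧inv d)) (ℤ.*-identityˡ _)))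
  (ℤ.+≤+ (s≤s e≤d)))

inv≤1 : ∀ d → inv d ≤ℚ 1ℚ
inv≤1 zero    = ℚ.≤ᵇ⇒≤ _
inv≤1 (suc d) = inv-antitone {d} {0} z≤n

0≤sumTo : ∀ m f → (∀ p → 0ℚ ≤ℚ f p) → 0ℚ ≤ℚ sumTo m f
0≤sumTo zero    f 0≤f = ℚ.≤-refl
0≤sumTo (suc m) f 0≤f = ℚ.+-mono-≤ (0≤sumTo m f 0≤f) (0≤f (suc m))

sumTo-mono : ∀ m {f g} → (∀ p → f p ≤ℚ g p) → sumTo m f ≤ℚ sumTo m g
sumTo-mono zero    f≤g = ℚ.≤-refl
sumTo-mono (suc m) f≤g = ℚ.+-mono-≤ (sumTo-mono m f≤g) (f≤g (suc m))

sumTo-cong : ∀ m {f g} → (∀ p → f p ≡ g p) → sumTo m f ≡ sumTo m g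
sumTo-cong zero    f≗g = refl
sumTo-cong (suc m) f≗g = cong₂ _+ℚ_ (sumTo-cong m f≗g) (f≗g (suc m))

sumTo-distrib-+ : ∀ m f g → sumTo m (λ p → f p +ℚ g p) ≡ sumTo m f +ℚ sumTo m g
sumTo-distrib-+ zero    f g = refl
sumTo-distrib-+ (suc m) f g =
  trans (cong (_+ℚ (f (suc m) +ℚ g (suc m))) (sumTo-distrib-+ m f g))
        (+ℚ-interchange (sumTo m f) (sumTo m g) (f (suc m)) (g (suc m)))

sumTo-zero : ∀ m → sumTo m (λ _ → 0ℚ) ≡ 0ℚ
sumTo-zero zero    = refl
sumTo-zero (suc m) = trans (ℚ.+-identityʳ _) (sumTo-zero m)

sumTo-single : ∀ m a c → 0ℚ ≤ℚ c → sumTo m (λ p → if p ≡ᵇ a then c else 0ℚ) ≤ℚ c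
sumTo-single m a c 0≤c = [ (λ e → subst (_≤ℚ c) (sym e) 0≤c) , (λ e → ℚ.≤-reflexive (proj₁ e)) ]′ (go m)
  where
  go : ∀ m → sumTo m (λ p → if p ≡ᵇ a then c else 0ℚ) ≡ 0ℚ
           ⊎ (sumTo m (λ p → if p ≡ᵇ a then c else 0ℚ) ≡ c × a ≤ m)
  go zero = inj₁ refl
  go (suc m) with suc m ≟ a | go m
  ... | yes refl | inj₁ e rewrite ≡⇒≡ᵇ≡true {suc m} refl = inj₂ (trans (cong (_+ℚ c) e) (ℚ.+-identityˡ c) , ≤-refl)
  ... | yes refl | inj₂ (_ , 1+m≤m) = ⊥-elim (1+n≰n 1+m≤m)
  ... | no 1+m≢a | inj₁ e rewrite ≢⇒≡ᵇ≡false 1+m≢a = inj₁ (trans (ℚ.+-identityʳ _) e)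
  ... | no 1+m≢a | inj₂ (e , a≤m) rewrite ≢⇒≡ᵇ≡false 1+m≢a = inj₂ (trans (ℚ.+-identityʳ _) e , m≤n⇒m≤1+n a≤m)

term≤sumTo : ∀ m f → (∀ p → 0ℚ ≤ℚ f p) → ∀ a → 1 ≤ a → a ≤ m → f a ≤ℚ sumTo m f
term≤sumTo zero    f 0≤f a 1≤a a≤0 = ⊥-elim (<⇒≱ 1≤a a≤0)
term≤sumTo (suc m) f 0≤f a 1≤a a≤1+m with a ≟ suc m
... | yes refl = subst (_≤ℚ sumTo m f +ℚ f (suc m)) (ℚ.+-identityˡ (f (suc m))) (ℚ.+-monoˡ-≤ (f (suc m)) (0≤sumTo m f 0≤f))
... | no a≢1+m = subst (_≤ℚ sumTo m f +ℚ f (suc m)) (ℚ.+-identityʳ (f a))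
                   (ℚ.+-mono-≤ (term≤sumTo m f 0≤f a 1≤a (≤-pred (≤∧≢⇒< a≤1+m a≢1+m))) (0≤f (suc m)))

terms≤sumTo : ∀ m f → (∀ p → 0ℚ ≤ℚ f p) → ∀ a b → 1 ≤ a → a < b → b ≤ m → f a +ℚ f b ≤ℚ sumTo m f
terms≤sumTo zero    f 0≤f a b 1≤a a<b b≤0 = ⊥-elim (<⇒≱ (<-≤-trans (s≤s z≤n) a<b) b≤0)
terms≤sumTo (suc m) f 0≤f a b 1≤a a<b b≤1+m with b ≟ suc m
... | yes refl = ℚ.+-monoˡ-≤ (f (suc m)) (term≤sumTo m f 0≤f a 1≤a (≤-pred a<b))
... | no b≢1+m = subst (_≤ℚ sumTo m f +ℚ f (suc m)) (ℚ.+-identityʳ (f a +ℚ f b))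
                   (ℚ.+-mono-≤ (terms≤sumTo m f 0≤f a b 1≤a a<b (≤-pred (≤∧≢⇒< b≤1+m b≢1+m))) (0≤f (suc m)))

Edge : Set
Edge = ℕ × ℕ

weightOf : List Edge → ℚ
weightOf []            = 0ℚ
weightOf ((p , q) ∷ E) = inv (q ∸ p) +ℚ weightOf E

weightAt : List Edge → ℕ → ℕ → ℚ
weightAt []            p q = 0ℚ
weightAt ((a , b) ∷ E) p q = (if (p ≡ᵇ a) ∧ (q ≡ᵇ b) then inv (b ∸ a) else 0ℚ) +ℚ weightAt E p q

private
  0≤head : ∀ a b p q → 0ℚ ≤ℚ (if (p ≡ᵇ a) ∧ (q ≡ᵇ b) then inv (b ∸ a) else 0ℚ)
  0≤head a b p q with (p ≡ᵇ a) ∧ (q ≡ᵇ b)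
  ... | true  = 0≤inv (b ∸ a)
  ... | false = ℚ.≤-refl

0≤weightAt : ∀ E p q → 0ℚ ≤ℚ weightAt E p q
0≤weightAt []            p q = ℚ.≤-refl
0≤weightAt ((a , b) ∷ E) p q = ℚ.+-mono-≤ (0≤head a b p q) (0≤weightAt E p q)

∈⇒inv≤weightAt : ∀ E p q → Any ((p , q) ≡_) E → inv (q ∸ p) ≤ℚ weightAt E p q
∈⇒inv≤weightAt ((a , b) ∷ E) p q (here refl) rewrite ≡⇒≡ᵇ≡true {p} refl | ≡⇒≡ᵇ≡true {q} refl =
  subst (_≤ℚ inv (q ∸ p) +ℚ weightAt E p q) (ℚ.+-identityʳ (inv (q ∸ p)))
        (ℚ.+-monoʳ-≤ (inv (q ∸ p)) (0≤weightAt E p q))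
∈⇒inv≤weightAt ((a , b) ∷ E) p q (there e∈E) =
  subst (_≤ℚ (if (p ≡ᵇ a) ∧ (q ≡ᵇ b) then inv (b ∸ a) else 0ℚ) +ℚ weightAt E p q) (ℚ.+-identityˡ (inv (q ∸ p)))
        (ℚ.+-mono-≤ (0≤head a b p q) (∈⇒inv≤weightAt E p q e∈E))

sumTo²-single : ∀ m a b c → 0ℚ ≤ℚ c →
  sumTo m (λ p → sumTo m (λ q → if (p ≡ᵇ a) ∧ (q ≡ᵇ b) then c else 0ℚ)) ≤ℚ c
sumTo²-single m a b c 0≤c = ℚ.≤-trans (sumTo-mono m row) (sumTo-single m a c 0≤c)
  where
  row : ∀ p → sumTo m (λ q → if (p ≡ᵇ a) ∧ (q ≡ᵇ b) then c else 0ℚ) ≤ℚ (if p ≡ᵇ a then c else 0ℚ)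
  row p with p ≡ᵇ a
  ... | true  = sumTo-single m b c 0≤c
  ... | false = ℚ.≤-reflexive (sumTo-zero m)

sumTo²-weightAt : ∀ m E → sumTo m (λ p → sumTo m (λ q → weightAt E p q)) ≤ℚ weightOf E
sumTo²-weightAt m [] = ℚ.≤-reflexive (trans (sumTo-cong m (λ _ → sumTo-zero m)) (sumTo-zero m))
sumTo²-weightAt m ((a , b) ∷ E) = subst (_≤ℚ inv (b ∸ a) +ℚ weightOf E) (sym split)
  (ℚ.+-mono-≤ (sumTo²-single m a b (inv (b ∸ a)) (0≤inv (b ∸ a))) (sumTo²-weightAt m E))
  where
  split : sumTo m (λ p → sumTo m (λ q → weightAt ((a , b) ∷ E) p q))
        ≡ sumTo m (λ p → sumTo m (λ q → if (p ≡ᵇ a) ∧ (q ≡ᵇ b) then inv (b ∸ a) else 0ℚ))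
          +ℚ sumTo m (λ p → sumTo m (λ q → weightAt E p q))
  split = trans (sumTo-cong m (λ p → sumTo-distrib-+ m _ (λ q → weightAt E p q))) (sumTo-distrib-+ m _ _)

_≟ᴱ_ : (e f : Edge) → Dec (e ≡ f)
_≟ᴱ_ = ≡-dec _≟_ _≟_

ShortOver : ℕ → Edge → Set
ShortOver v (p , q) = (p ≡ v ∸ 1 × q ≡ suc v) ⊎ (p ≡ v × q ≡ suc v) ⊎ (p ≡ v × q ≡ suc (suc v))

shortOver? : ∀ v e → Dec (ShortOver v e)
shortOver? v (p , q) = (p ≟ v ∸ 1 ×-dec q ≟ suc v) ⊎-dec (p ≟ v ×-dec q ≟ suc v) ⊎-dec (p ≟ v ×-dec q ≟ suc (suc v))

private
  span-length : ∀ {p q v} → p ≤ v → v < q → ∃[ o ] (q ≡ suc (p + o) × q ∸ p ≡ suc o)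
  span-length {p} p≤v v<q with m≤n⇒∃[o]m+o≡n (≤-trans (s≤s p≤v) v<q)
  ... | o , refl = o , refl , trans (cong (_∸ p) (sym (+-suc p o))) (m+n∸m≡n p (suc o))

  unit-span : ∀ {p q v} → p ≤ v → v < q → q ≡ suc (p + 0) → p ≡ v × q ≡ suc v
  unit-span {p} p≤v v<q q≡1+p rewrite +-identityʳ p = p≡v , trans q≡1+p (cong suc p≡v)
    where p≡v = ≤-antisym p≤v (≤-pred (subst (_ <_) q≡1+p v<q))

inv≤½-unless-unit : ∀ {p q v} → p ≤ v → v < q → (p , q) ≢ (v , suc v) → inv (q ∸ p) ≤ℚ inv 2
inv≤½-unless-unit p≤v v<q ≢unit with span-length p≤v v<q
... | zero  , q≡ , _    = ⊥-elim (≢unit (cong₂ _,_ (proj₁ (unit-span p≤v v<q q≡)) (proj₂ (unit-span p≤v v<q q≡))))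
... | suc o , _ , len rewrite len = inv-antitone {suc o} {1} (s≤s z≤n)

inv≤⅓-unless-short : ∀ {p q v} → p ≤ v → v < q → ¬ ShortOver v (p , q) → inv (q ∸ p) ≤ℚ inv 3
inv≤⅓-unless-short p≤v v<q ¬short with span-length p≤v v<q
... | zero , q≡ , _ = ⊥-elim (¬short (inj₂ (inj₁ (unit-span p≤v v<q q≡))))
... | suc zero , q≡ , _ = ⊥-elim (¬short (length-two p≤v v<q (trans q≡ (cong suc (+-comm _ 1)))))
  where
  length-two : ∀ {p q v} → p ≤ v → v < q → q ≡ suc (suc p) → ShortOver v (p , q)
  length-two {p} {q} {v} p≤v v<q q≡2+p with p ≟ v
  ... | yes p≡v = inj₂ (inj₂ (p≡v , trans q≡2+p (cong (λ z → suc (suc z)) p≡v)))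
  ... | no p≢v  = inj₁ (cong (_∸ 1) 1+p≡v , trans q≡2+p (cong suc 1+p≡v))
    where 1+p≡v = ≤-antisym (≤∧≢⇒< p≤v p≢v) (≤-pred (subst (v <_) q≡2+p v<q))
... | suc (suc o) , _ , len rewrite len = inv-antitone {suc (suc o)} {2} (s≤s (s≤s z≤n))

-- Only (v , v+1) has length one, so two distinct edges over [v, v+1] weigh at most 1 + 1/2.
two-edges-over≤3/2 : ∀ {p₁ q₁ p₂ q₂ v} → p₁ ≤ v → v < q₁ → p₂ ≤ v → v < q₂ → (p₁ , q₁) ≢ (p₂ , q₂) →
                     inv (q₁ ∸ p₁) +ℚ (inv (q₂ ∸ p₂) +ℚ 0ℚ) ≤ℚ ℤ.+ 3 / 2
two-edges-over≤3/2 {p₁} {q₁} {p₂} {q₂} {v} p₁≤v v<q₁ p₂≤v v<q₂ e₁≢e₂ with (p₁ , q₁) ≟ᴱ (v , suc v)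
... | yes refl = ℚ.≤-trans
  (ℚ.+-mono-≤ (inv≤1 (q₁ ∸ p₁)) (ℚ.+-monoˡ-≤ 0ℚ (inv≤½-unless-unit p₂≤v v<q₂ (e₁≢e₂ ∘ sym)))) (ℚ.≤ᵇ⇒≤ _)
... | no e₁≢unit = ℚ.≤-trans
  (ℚ.+-mono-≤ (inv≤½-unless-unit p₁≤v v<q₁ e₁≢unit) (ℚ.+-monoˡ-≤ 0ℚ (inv≤1 (q₂ ∸ p₂)))) (ℚ.≤ᵇ⇒≤ _)

-- Weights of unit intervals

module Weights {n k : ℕ} (P : MonotoneWSPath n k) where
  open Crossings P

  edgeOf : ℕ → Edge
  edgeOf a = y P a , x P a

  isEdge⇒step : ∀ {p q} → isEdge P p q ≡ true → ∃[ a ] (1 ≤ a × a ≤ N P × y P a ≡ p × x P a ≡ q)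
  isEdge⇒step {p} {q} e with applyUpTo⁻ _ (map⁻ (any⁻ (λ a → (y P a ≡ᵇ p) ∧ (x P a ≡ᵇ q)) _ (≡true⇒T e)))
  ... | i , i<N , t = suc i , s≤s z≤n , i<N , ≡ᵇ≡true⇒≡ (∧-elimˡ (T⇒≡true t))
                    , ≡ᵇ≡true⇒≡ (∧-elimʳ {y P (suc i) ≡ᵇ p} (T⇒≡true t))

  step⇒isEdge : ∀ a → 1 ≤ a → a ≤ N P → isEdge P (y P a) (x P a) ≡ true
  step⇒isEdge (suc i) _ 1+i≤N = T⇒≡true (any⁺ _ (map⁺ (applyUpTo⁺ _ {i} (≡true⇒T same) 1+i≤N)))
    where
    same : ((y P (suc i) ≡ᵇ y P (suc i)) ∧ (x P (suc i) ≡ᵇ x P (suc i))) ≡ true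
    same = ∧-intro (≡⇒≡ᵇ≡true {y P (suc i)} refl) (≡⇒≡ᵇ≡true {x P (suc i)} refl)

  share : ℕ → ℕ → ℕ → ℚ
  share v p q = if isEdge P p q ∧ (p ≤ᵇ v) ∧ (suc v ≤ᵇ q) then inv (q ∸ p) else 0ℚ

  0≤share : ∀ v p q → 0ℚ ≤ℚ share v p q
  0≤share v p q with isEdge P p q ∧ (p ≤ᵇ v) ∧ (suc v ≤ᵇ q)
  ... | true  = 0≤inv (q ∸ p)
  ... | false = ℚ.≤-refl

  Covers : ℕ → List Edge → Set
  Covers v E = ∀ p q → isEdge P p q ≡ true → p ≤ v → v < q → Any ((p , q) ≡_) E

  wt≤weightOf : ∀ {v} E → Covers v E → wt P v ≤ℚ weightOf E
  wt≤weightOf {v} E cover = ℚ.≤-trans (sumTo-mono n (λ p → sumTo-mono n (share≤weightAt p))) (sumTo²-weightAt n E)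
    where
    share≤weightAt : ∀ p q → share v p q ≤ℚ weightAt E p q
    share≤weightAt p q with isEdge P p q ∧ (p ≤ᵇ v) ∧ (suc v ≤ᵇ q) in c
    ... | true  = ∈⇒inv≤weightAt E p q (cover p q (∧-elimˡ c) (≤ᵇ≡true⇒≤ (∧-elimˡ (∧-elimʳ {isEdge P p q} c)))
                                                         (≤ᵇ≡true⇒≤ (∧-elimʳ {p ≤ᵇ v} (∧-elimʳ {isEdge P p q} c))))
    ... | false = 0≤weightAt E p q

  crossingSteps-cover : ∀ {v} E → (∀ a → Any (a ≡_) (crossingSteps v (N P)) → Any (edgeOf a ≡_) E) → Covers v E
  crossingSteps-cover E cover p q pq p≤v v<q with isEdge⇒step pq
  ... | a , 1≤a , a≤N , refl , refl = cover a (∈-crossingSteps⁺ 1≤a a≤N (crosses-intro p≤v v<q))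

  -- The three short edges over [v, v+1] already weigh 1/2 + 1 + 1/2 = 2 > 11/6.
  short-triple⇒11/6<wt : ∀ v → 2 ≤ v → v + 2 ≤ n →
    isEdge P (v ∸ 1) (suc v) ≡ true → isEdge P v (suc v) ≡ true → isEdge P v (suc (suc v)) ≡ true →
    ℤ.+ 11 / 6 <ℚ wt P v
  short-triple⇒11/6<wt (suc u) (s≤s 1≤u) 3+u≤n e₁ e₂ e₃ =
    ℚ.<-≤-trans (toWitness {a? = ℤ.+ 11 / 6 ℚ.<? inv 2 +ℚ (inv 1 +ℚ inv 2)} _) two≤wt
    where
    v = suc u
    3+u≤n′ : suc (suc v) ≤ n
    3+u≤n′ = subst (_≤ n) (+-comm v 2) 3+u≤n
    at : ∀ {p} l → isEdge P p (l + p) ≡ true → p ≤ v → v < l + p → inv l ≤ℚ share v p (l + p)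
    at {p} l pq p≤v v<q rewrite pq | ≤⇒≤ᵇ≡true p≤v | ≤⇒≤ᵇ≡true v<q | m+n∸n≡m l p = ℚ.≤-refl
    two≤wt : inv 2 +ℚ (inv 1 +ℚ inv 2) ≤ℚ wt P v
    two≤wt = ℚ.≤-trans
      (ℚ.+-mono-≤ (at 2 e₁ (n≤1+n u) ≤-refl) (ℚ.+-mono-≤ (at 1 e₂ ≤-refl ≤-refl) (at 2 e₃ ≤-refl (n≤1+n _))))
      (ℚ.≤-trans (ℚ.+-mono-≤ (term≤sumTo n (share v u) (0≤share v u) (suc v) (s≤s z≤n) (<⇒≤ 3+u≤n′))
                             (terms≤sumTo n (share v v) (0≤share v v) (suc v) (suc (suc v)) (s≤s z≤n) ≤-refl 3+u≤n′))
                 (terms≤sumTo n (λ p → sumTo n (share v p)) (λ p → 0≤sumTo n (share v p) (0≤share v p))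
                              u v 1≤u ≤-refl (<⇒≤ (<⇒≤ 3+u≤n′))))

  NoShortTriple : ℕ → Set
  NoShortTriple v =
    ¬ (isEdge P (v ∸ 1) (suc v) ≡ true × isEdge P v (suc v) ≡ true × isEdge P v (suc (suc v)) ≡ true)

  Covers-⊆ : ∀ {v E F} → Covers v E → (∀ {e} → Any (e ≡_) E → Any (e ≡_) F) → Covers v F
  Covers-⊆ cover E⊆F p q pq p≤v v<q = E⊆F (cover p q pq p≤v v<q)

  steps-cover : ∀ {v L} → crossingSteps v (N P) ≡ L → ∀ E →
                (∀ a → Any (a ≡_) L → Any (edgeOf a ≡_) E) → Covers v E
  steps-cover L≡ E cover = crossingSteps-cover E (λ a a∈ → cover a (subst (Any (a ≡_)) L≡ a∈))

  listed⇒crosses : ∀ {v L a} → crossingSteps v (N P) ≡ L → Any (a ≡_) L → crosses a v ≡ true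
  listed⇒crosses {a = a} L≡ a∈ = proj₂ (proj₂ (∈-crossingSteps⁻ {t = N P} (subst (Any (a ≡_)) (sym L≡) a∈)))

  wt≤1-one-edge : ∀ {v} a → Covers v (edgeOf a ∷ []) → wt P v ≤ℚ 1ℚ
  wt≤1-one-edge {v} a cover =
    ℚ.≤-trans (wt≤weightOf _ cover) (ℚ.≤-trans (ℚ.+-monoˡ-≤ 0ℚ (inv≤1 (x P a ∸ y P a))) (ℚ.≤ᵇ⇒≤ _))

  wt≤3/2-two-edges : ∀ {v} a b → crosses a v ≡ true → crosses b v ≡ true →
                     Covers v (edgeOf a ∷ edgeOf b ∷ []) → wt P v ≤ℚ ℤ.+ 3 / 2
  wt≤3/2-two-edges {v} a b ca cb cover with edgeOf a ≟ᴱ edgeOf b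
  ... | yes eab = ℚ.≤-trans (wt≤1-one-edge a (Covers-⊆ cover ⊆)) (ℚ.≤ᵇ⇒≤ _)
    where
    ⊆ : ∀ {e} → Any (e ≡_) (edgeOf a ∷ edgeOf b ∷ []) → Any (e ≡_) (edgeOf a ∷ [])
    ⊆ (here e≡)         = here e≡
    ⊆ (there (here e≡)) = here (trans e≡ (sym eab))
  ... | no a≢b = ℚ.≤-trans (wt≤weightOf _ cover)
    (two-edges-over≤3/2 (crosses⇒y≤ ca) (crosses⇒<x ca) (crosses⇒y≤ cb) (crosses⇒<x cb) a≢b)

  wt≤11/6-with-long-edge : ∀ {v} a b c → crosses a v ≡ true → crosses b v ≡ true → crosses c v ≡ true →
    ¬ ShortOver v (edgeOf a) → edgeOf b ≢ edgeOf c →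
    Covers v (edgeOf a ∷ edgeOf b ∷ edgeOf c ∷ []) → wt P v ≤ℚ ℤ.+ 11 / 6
  wt≤11/6-with-long-edge a b c ca cb cc long b≢c cover = ℚ.≤-trans (wt≤weightOf _ cover)
    (ℚ.≤-trans (ℚ.+-mono-≤ (inv≤⅓-unless-short (crosses⇒y≤ ca) (crosses⇒<x ca) long)
                           (two-edges-over≤3/2 (crosses⇒y≤ cb) (crosses⇒<x cb) (crosses⇒y≤ cc) (crosses⇒<x cc) b≢c))
               (ℚ.≤ᵇ⇒≤ _))

  record HeavyShape (v : ℕ) : Set where
    field
      short    : ∀ a → 1 ≤ a → a ≤ N P → crosses a v ≡ true → ShortOver v (edgeOf a)
      distinct : ∀ a b → 1 ≤ a → a ≤ N P → 1 ≤ b → b ≤ N P → crosses a v ≡ true → crosses b v ≡ true →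
                 edgeOf a ≡ edgeOf b → a ≡ b

  distinct-short⇒HeavyShape : ∀ {v} c₁ c₂ c₃ → crossingSteps v (N P) ≡ c₁ ∷ c₂ ∷ c₃ ∷ [] →
    edgeOf c₁ ≢ edgeOf c₂ → edgeOf c₁ ≢ edgeOf c₃ → edgeOf c₂ ≢ edgeOf c₃ →
    ShortOver v (edgeOf c₁) → ShortOver v (edgeOf c₂) → ShortOver v (edgeOf c₃) → HeavyShape v
  distinct-short⇒HeavyShape {v} c₁ c₂ c₃ L≡ e₁≢e₂ e₁≢e₃ e₂≢e₃ s₁ s₂ s₃ = record { short = short ; distinct = distinct }
    where
    listed : ∀ a → 1 ≤ a → a ≤ N P → crosses a v ≡ true → Any (a ≡_) (c₁ ∷ c₂ ∷ c₃ ∷ [])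
    listed a 1≤a a≤N ca = subst (Any (a ≡_)) L≡ (∈-crossingSteps⁺ 1≤a a≤N ca)
    short : ∀ a → 1 ≤ a → a ≤ N P → crosses a v ≡ true → ShortOver v (edgeOf a)
    short a 1≤a a≤N ca with listed a 1≤a a≤N ca
    ... | here refl                 = s₁
    ... | there (here refl)         = s₂
    ... | there (there (here refl)) = s₃
    distinct : ∀ a b → 1 ≤ a → a ≤ N P → 1 ≤ b → b ≤ N P → crosses a v ≡ true → crosses b v ≡ true →
               edgeOf a ≡ edgeOf b → a ≡ b
    distinct a b 1≤a a≤N 1≤b b≤N ca cb eab with listed a 1≤a a≤N ca | listed b 1≤b b≤N cb
    ... | here refl                 | here refl                 = refl
    ... | here refl                 | there (here refl)         = ⊥-elim (e₁≢e₂ eab)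
    ... | here refl                 | there (there (here refl)) = ⊥-elim (e₁≢e₃ eab)
    ... | there (here refl)         | here refl                 = ⊥-elim (e₁≢e₂ (sym eab))
    ... | there (here refl)         | there (here refl)         = refl
    ... | there (here refl)         | there (there (here refl)) = ⊥-elim (e₂≢e₃ eab)
    ... | there (there (here refl)) | here refl                 = ⊥-elim (e₁≢e₃ (sym eab))
    ... | there (there (here refl)) | there (here refl)         = ⊥-elim (e₂≢e₃ (sym eab))
    ... | there (there (here refl)) | there (there (here refl)) = refl

  three-listed-crossings : ∀ {v} c₁ c₂ c₃ → crossingSteps v (N P) ≡ c₁ ∷ c₂ ∷ c₃ ∷ [] →
                           HeavyShape v ⊎ wt P v ≤ℚ ℤ.+ 11 / 6
  three-listed-crossings {v} c₁ c₂ c₃ L≡ =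
    classify (listed⇒crosses L≡ (here refl)) (listed⇒crosses L≡ (there (here refl)))
             (listed⇒crosses L≡ (there (there (here refl))))
    where
    classify : crosses c₁ v ≡ true → crosses c₂ v ≡ true → crosses c₃ v ≡ true → HeavyShape v ⊎ wt P v ≤ℚ ℤ.+ 11 / 6
    classify x₁ x₂ x₃ with edgeOf c₁ ≟ᴱ edgeOf c₂ | edgeOf c₁ ≟ᴱ edgeOf c₃ | edgeOf c₂ ≟ᴱ edgeOf c₃
    ... | yes e₁₂ | _ | _ = inj₂ (ℚ.≤-trans (wt≤3/2-two-edges c₁ c₃ x₁ x₃ (steps-cover L≡ _ cover)) (ℚ.≤ᵇ⇒≤ _))
      where
      cover : ∀ a → Any (a ≡_) (c₁ ∷ c₂ ∷ c₃ ∷ []) → Any (edgeOf a ≡_) (edgeOf c₁ ∷ edgeOf c₃ ∷ [])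
      cover a (here refl)                 = here refl
      cover a (there (here refl))         = here (sym e₁₂)
      cover a (there (there (here refl))) = there (here refl)
    ... | no _ | yes e₁₃ | _ = inj₂ (ℚ.≤-trans (wt≤3/2-two-edges c₁ c₂ x₁ x₂ (steps-cover L≡ _ cover)) (ℚ.≤ᵇ⇒≤ _))
      where
      cover : ∀ a → Any (a ≡_) (c₁ ∷ c₂ ∷ c₃ ∷ []) → Any (edgeOf a ≡_) (edgeOf c₁ ∷ edgeOf c₂ ∷ [])
      cover a (here refl)                 = here refl
      cover a (there (here refl))         = there (here refl)
      cover a (there (there (here refl))) = here (sym e₁₃)
    ... | no _ | no _ | yes e₂₃ = inj₂ (ℚ.≤-trans (wt≤3/2-two-edges c₁ c₂ x₁ x₂ (steps-cover L≡ _ cover)) (ℚ.≤ᵇ⇒≤ _))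
      where
      cover : ∀ a → Any (a ≡_) (c₁ ∷ c₂ ∷ c₃ ∷ []) → Any (edgeOf a ≡_) (edgeOf c₁ ∷ edgeOf c₂ ∷ [])
      cover a (here refl)                 = here refl
      cover a (there (here refl))         = there (here refl)
      cover a (there (there (here refl))) = there (here (sym e₂₃))
    ... | no e₁≢e₂ | no e₁≢e₃ | no e₂≢e₃
      with shortOver? v (edgeOf c₁) | shortOver? v (edgeOf c₂) | shortOver? v (edgeOf c₃)
    ...   | yes s₁ | yes s₂ | yes s₃ = inj₁ (distinct-short⇒HeavyShape c₁ c₂ c₃ L≡ e₁≢e₂ e₁≢e₃ e₂≢e₃ s₁ s₂ s₃)
    ...   | no l₁ | _ | _ = inj₂ (wt≤11/6-with-long-edge c₁ c₂ c₃ x₁ x₂ x₃ l₁ e₂≢e₃ (steps-cover L≡ _ cover))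
      where
      cover : ∀ a → Any (a ≡_) (c₁ ∷ c₂ ∷ c₃ ∷ []) → Any (edgeOf a ≡_) (edgeOf c₁ ∷ edgeOf c₂ ∷ edgeOf c₃ ∷ [])
      cover a (here refl)                 = here refl
      cover a (there (here refl))         = there (here refl)
      cover a (there (there (here refl))) = there (there (here refl))
    ...   | yes _ | no l₂ | _ = inj₂ (wt≤11/6-with-long-edge c₂ c₁ c₃ x₂ x₁ x₃ l₂ e₁≢e₃ (steps-cover L≡ _ cover))
      where
      cover : ∀ a → Any (a ≡_) (c₁ ∷ c₂ ∷ c₃ ∷ []) → Any (edgeOf a ≡_) (edgeOf c₂ ∷ edgeOf c₁ ∷ edgeOf c₃ ∷ [])
      cover a (here refl)                 = there (here refl)
      cover a (there (here refl))         = here refl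
      cover a (there (there (here refl))) = there (there (here refl))
    ...   | yes _ | yes _ | no l₃ = inj₂ (wt≤11/6-with-long-edge c₃ c₁ c₂ x₃ x₁ x₂ l₃ e₁≢e₂ (steps-cover L≡ _ cover))
      where
      cover : ∀ a → Any (a ≡_) (c₁ ∷ c₂ ∷ c₃ ∷ []) → Any (edgeOf a ≡_) (edgeOf c₃ ∷ edgeOf c₁ ∷ edgeOf c₂ ∷ [])
      cover a (here refl)                 = there (here refl)
      cover a (there (here refl))         = there (there (here refl))
      cover a (there (there (here refl))) = here refl

  one-crossing : ∀ {v} → length (crossingSteps v (N P)) ≡ 1 → wt P v ≤ℚ 1ℚ
  one-crossing {v} count with crossingSteps v (N P) in L≡
  ... | c ∷ [] = wt≤1-one-edge c (steps-cover L≡ _ λ { a (here refl) → here refl })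

  two-crossings : ∀ {v} → length (crossingSteps v (N P)) ≡ 2 → wt P v ≤ℚ ℤ.+ 3 / 2
  two-crossings {v} count with crossingSteps v (N P) in L≡
  ... | c₁ ∷ c₂ ∷ [] = wt≤3/2-two-edges c₁ c₂ (listed⇒crosses L≡ (here refl)) (listed⇒crosses L≡ (there (here refl)))
    (steps-cover L≡ _ λ { a (here refl) → here refl ; a (there (here refl)) → there (here refl) })

  three-crossings : ∀ {v} → length (crossingSteps v (N P)) ≡ 3 → HeavyShape v ⊎ wt P v ≤ℚ ℤ.+ 11 / 6
  three-crossings {v} count with crossingSteps v (N P) in L≡
  ... | c₁ ∷ c₂ ∷ c₃ ∷ [] = three-listed-crossings c₁ c₂ c₃ L≡

1≤wtlim : ∀ n v → 1ℚ ≤ℚ wtlim n v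
1≤wtlim n v with (v ≡ᵇ 1) ∨ (v ≡ᵇ n ∸ 1)
... | true = ℚ.≤-refl
... | false with (v ≡ᵇ 2) ∨ (v ≡ᵇ n ∸ 2)
...   | true  = ℚ.≤ᵇ⇒≤ _
...   | false = ℚ.≤ᵇ⇒≤ _

wtlim≤11/6 : ∀ n v → wtlim n v ≤ℚ ℤ.+ 11 / 6
wtlim≤11/6 n v with (v ≡ᵇ 1) ∨ (v ≡ᵇ n ∸ 1)
... | true = ℚ.≤ᵇ⇒≤ _
... | false with (v ≡ᵇ 2) ∨ (v ≡ᵇ n ∸ 2)
...   | true  = ℚ.≤ᵇ⇒≤ _
...   | false = ℚ.≤-refl

3/2≤wtlim : ∀ n v → v ≢ 1 → v ≢ n ∸ 1 → ℤ.+ 3 / 2 ≤ℚ wtlim n v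
3/2≤wtlim n v v≢1 v≢n-1 rewrite ≢⇒≡ᵇ≡false v≢1 | ≢⇒≡ᵇ≡false v≢n-1 with (v ≡ᵇ 2) ∨ (v ≡ᵇ n ∸ 2)
... | true  = ℚ.≤-refl
... | false = ℚ.≤ᵇ⇒≤ _

wtlim-inner : ∀ n v → v ≢ 1 → v ≢ 2 → v ≢ n ∸ 1 → v ≢ n ∸ 2 → wtlim n v ≡ ℤ.+ 11 / 6
wtlim-inner n v v≢1 v≢2 v≢n-1 v≢n-2
  rewrite ≢⇒≡ᵇ≡false v≢1 | ≢⇒≡ᵇ≡false v≢2 | ≢⇒≡ᵇ≡false v≢n-1 | ≢⇒≡ᵇ≡false v≢n-2 = refl

-- Heavy intervals of a path from {1,2,3} to {d+1,d+2,d+3}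

module HeavyIntervals (d : ℕ) (3≤d : 3 ≤ d) (P : MonotoneWSPath (3 + d) 3)
             (start : ∀ z → A P 0 z ≡ ⟦ 1 , 2 , 3 ⟧ z) (end : ∀ z → A P (N P) z ≡ lastThree d z) where

  open Crossings P
  open Weights P

  crossing-count : ∀ {v c e} → card (lastThree d) v ≡ e → card ⟦ 1 , 2 , 3 ⟧ v ≡ c + e →
                   length (crossingSteps v (N P)) ≡ c
  crossing-count {v} {c} {e} last≡ first≡ = +-cancelʳ-≡ e _ c (begin
    length (crossingSteps v (N P)) + e                   ≡⟨ cong (_ +_) (trans (card-cong end v) last≡) ⟨
    length (crossingSteps v (N P)) + card (A P (N P)) v  ≡⟨ length-crossingSteps v (N P) ≤-refl ⟩
    card (A P 0) v                                       ≡⟨ card-cong start v ⟩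
    card ⟦ 1 , 2 , 3 ⟧ v                                  ≡⟨ first≡ ⟩
    c + e                                                ∎)
    where open ≡-Reasoning

  outside⇒light : ∀ v → (v ≡ 0 ⊎ 3 + d ≤ v) → wt P v ≤ℚ wtlim (3 + d) v
  outside⇒light v outside = ℚ.≤-trans (wt≤weightOf [] none) (ℚ.≤-trans (ℚ.≤ᵇ⇒≤ _) (1≤wtlim (3 + d) v))
    where
    none : Covers v []
    none p q pq p≤v v<q with isEdge⇒step pq
    ... | a , 1≤a , a≤N , refl , refl = ⊥-elim ([ (λ { refl → <⇒≱ (1≤y a 1≤a a≤N) p≤v })
                                                 , <⇒≱ (<-≤-trans v<q (x≤n a 1≤a a≤N)) ]′ outside)

  heavy-interval : ∀ v → wtlim (3 + d) v <ℚ wt P v → 3 ≤ v × v ≤ d × HeavyShape v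
  heavy-interval v heavy with v ≟ 0 | 3 + d ≤? v
  ... | yes v≡0 | _       = ⊥-elim (<⇒≱ℚ heavy (outside⇒light v (inj₁ v≡0)))
  ... | no _    | yes n≤v = ⊥-elim (<⇒≱ℚ heavy (outside⇒light v (inj₂ n≤v)))
  ... | no v≢0 | no v<n with v ≟ 1 | v ≟ 2 | v ≟ suc d | v ≟ suc (suc d)
  ...   | yes refl | _ | _ | _ = ⊥-elim (<⇒≱ℚ heavy
           (one-crossing (crossing-count (card-lastThree-≤ d 1 (≤-trans (s≤s z≤n) 3≤d)) refl)))
  ...   | no _ | yes refl | _ | _ = ⊥-elim (<⇒≱ℚ heavy (ℚ.≤-trans
           (two-crossings (crossing-count (card-lastThree-≤ d 2 (≤-trans (s≤s (s≤s z≤n)) 3≤d)) refl))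
           (3/2≤wtlim (3 + d) 2 (λ ()) (λ 2≡2+d → <⇒≢ (≤-trans (s≤s z≤n) 3≤d) (suc-injective (suc-injective 2≡2+d))))))
  ...   | no _ | no _ | yes refl | _ = ⊥-elim (<⇒≱ℚ heavy (ℚ.≤-trans
           (two-crossings (crossing-count (card-lastThree-1+m d) (card-⟦1,2,3⟧ (m≤n⇒m≤1+n 3≤d))))
           (3/2≤wtlim (3 + d) (suc d) (λ 1+d≡1 → <⇒≢ (≤-trans (s≤s z≤n) 3≤d) (sym (suc-injective 1+d≡1)))
                                      (λ e → 1+n≢n (sym e)))))
  ...   | no _ | no _ | no _ | yes refl = ⊥-elim (<⇒≱ℚ heavy (ℚ.≤-trans
           (one-crossing (crossing-count (card-lastThree-2+m d) (card-⟦1,2,3⟧ (m≤n⇒m≤1+n (m≤n⇒m≤1+n 3≤d)))))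
           (1≤wtlim (3 + d) (suc (suc d)))))
  ...   | no v≢1 | no v≢2 | no v≢1+d | no v≢2+d = 3≤v , v≤d , shape
    where
    3≤v : 3 ≤ v
    3≤v = ≤∧≢⇒< (≤∧≢⇒< (≤∧≢⇒< z≤n (v≢0 ∘ sym)) (v≢1 ∘ sym)) (v≢2 ∘ sym)
    v≤d : v ≤ d
    v≤d = ≤-pred (≤∧≢⇒< (≤-pred (≤∧≢⇒< (≤-pred (≰⇒> v<n)) v≢2+d)) v≢1+d)
    shape : HeavyShape v
    shape with three-crossings (crossing-count (card-lastThree-≤ d v v≤d) (card-⟦1,2,3⟧ 3≤v))
    ... | inj₁ s   = s
    ... | inj₂ wt≤ = ⊥-elim (<⇒≱ℚ heavy (subst (wt P v ≤ℚ_) (sym (wtlim-inner (3 + d) v v≢1 v≢2 v≢2+d v≢1+d)) wt≤))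

-- Exhaustive search in a window

open import Data.List.Membership.DecPropositional _≟ᴱ_ using (_∈?_)

-- entry j is |A_t ∩ [1, w₀ + j]|, for j < width
Profile : Set
Profile = List ℕ

-- a step lowers the profile by one on an interval [lo, hi) of entries
Move : Set
Move = ℕ × ℕ

tabulateFrom : ℕ → ℕ → (ℕ → ℕ) → Profile
tabulateFrom i zero    f = []
tabulateFrom i (suc K) f = f i ∷ tabulateFrom (suc i) K f

inside : ℕ → ℕ → ℕ → Bool
inside lo hi j = (lo ≤ᵇ j) ∧ (j <ᵇ hi)

lowerOn : ℕ → ℕ → ℕ → Profile → Profile
lowerOn lo hi j []       = []
lowerOn lo hi j (c ∷ cs) = (if inside lo hi j then c ∸ 1 else c) ∷ lowerOn lo hi (suc j) cs

positiveOn : ℕ → ℕ → ℕ → Profile → Bool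
positiveOn lo hi j []       = true
positiveOn lo hi j (c ∷ cs) = (if inside lo hi j then 1 ≤ᵇ c else true) ∧ positiveOn lo hi (suc j) cs

dominates : Profile → Profile → Bool
dominates (c ∷ cs) (d ∷ ds) = (d ≤ᵇ c) ∧ dominates cs ds
dominates []       []       = true
dominates _        _        = false

unitStepsFrom : ℕ → Profile → Bool
unitStepsFrom c []       = true
unitStepsFrom c (d ∷ ds) = (c ≤ᵇ d) ∧ (d ≤ᵇ suc c) ∧ unitStepsFrom d ds

unitSteps : Profile → Bool
unitSteps []       = true
unitSteps (c ∷ cs) = unitStepsFrom c cs

noDipFrom : Bool → ℕ → List ℕ → Bool
noDipFrom fallen c []       = true
noDipFrom fallen c (d ∷ ds) =
  if d <ᵇ c then noDipFrom true d ds
  else if c <ᵇ d then not fallen ∧ noDipFrom fallen d ds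
  else noDipFrom fallen d ds

noDip : List ℕ → Bool
noDip []       = true
noDip (c ∷ cs) = noDipFrom false c cs

used : Move → List Move → Bool
used m ms = ⌊ m ∈? ms ⌋

-- at a heavy entry the crossing edges are the three distinct short ones (see HeavyShape)
heavyOK : List ℕ → Move → List Move → Bool
heavyOK hs (lo , hi) ms =
  all (λ h → if inside lo hi h then ⌊ shortOver? h (lo , hi) ⌋ ∧ not (used (lo , hi) ms) else true) hs

lightOK : List ℕ → List Move → Bool
lightOK ls ms = all (λ h → not (used (h ∸ 1 , suc h) ms ∧ used (h , suc h) ms ∧ used (h , suc (suc h)) ms)) ls

-- an offset h stands for the unit interval [w₀ + h, w₀ + h + 1]
record Window : Set where
  constructor window
  field
    width                     : ℕ
    heavyOffsets lightOffsets : List ℕ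

open Window

admissible : Window → Profile → Profile → List Profile → Move → List Move → Bool
admissible W target new history m ms =
  dominates new target ∧ unitSteps new ∧ heavyOK (heavyOffsets W) m ms ∧ all (λ s → noDip (zipWith _∸_ s new)) history

from : ℕ → ℕ → List ℕ
from lo k = applyUpTo (lo +_) k

-- history lists the profiles before the current one, ms the moves made so far
search : Window → Profile → ℕ → List Profile → List Move → Bool
search W target zero    _                   ms = false
search W target (suc f) []                  ms = false
search W target (suc f) (current ∷ history) ms =
  (⌊ List.≡-dec _≟_ current target ⌋ ∧ lightOK (lightOffsets W) ms) ∨
  any (λ lo → any (λ hi →
      positiveOn lo hi 0 current ∧
      (admissible W target (lowerOn lo hi 0 current) (current ∷ history) (lo , hi) ms ∧
       search W target f (lowerOn lo hi 0 current ∷ current ∷ history) ((lo , hi) ∷ ms)))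
    (from (suc lo) (width W ∸ lo))) (upTo (width W))

any-range⁺ : ∀ (p : ℕ → Bool) f k i → i < k → p (f i) ≡ true → any p (applyUpTo f k) ≡ true
any-range⁺ p f k i i<k pfi = T⇒≡true (any⁺ p (applyUpTo⁺ f (≡true⇒T pfi) i<k))

any-from⁺ : ∀ (p : ℕ → Bool) lo k i → lo ≤ i → i < lo + k → p i ≡ true → any p (from lo k) ≡ true
any-from⁺ p lo k i lo≤i i<lo+k pi = any-range⁺ p (lo +_) k (i ∸ lo)
  (subst (i ∸ lo <_) (m+n∸m≡n lo k) (∸-monoˡ-< i<lo+k lo≤i))
  (subst (λ z → p z ≡ true) (sym (m+[n∸m]≡n lo≤i)) pi)

tabulateFrom-cong : ∀ i K {f g : ℕ → ℕ} → (∀ j → i ≤ j → j < i + K → f j ≡ g j) →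
                    tabulateFrom i K f ≡ tabulateFrom i K g
tabulateFrom-cong i zero    f≗g = refl
tabulateFrom-cong i (suc K) f≗g = cong₂ _∷_
  (f≗g i ≤-refl (subst (i <_) (sym (+-suc i K)) (s≤s (m≤m+n i K))))
  (tabulateFrom-cong (suc i) K (λ j 1+i≤j j<1+i+K → f≗g j (<⇒≤ 1+i≤j) (subst (j <_) (sym (+-suc i K)) j<1+i+K)))

lowerOn-tabulateFrom : ∀ lo hi i K f →
  lowerOn lo hi i (tabulateFrom i K f) ≡ tabulateFrom i K (λ j → if inside lo hi j then f j ∸ 1 else f j)
lowerOn-tabulateFrom lo hi i zero    f = refl
lowerOn-tabulateFrom lo hi i (suc K) f = cong (_ ∷_) (lowerOn-tabulateFrom lo hi (suc i) K f)

positiveOn-tabulateFrom : ∀ lo hi i K f → (∀ j → lo ≤ j → j < hi → 1 ≤ f j) →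
                          positiveOn lo hi i (tabulateFrom i K f) ≡ true
positiveOn-tabulateFrom lo hi i zero    f pos = refl
positiveOn-tabulateFrom lo hi i (suc K) f pos = ∧-intro head (positiveOn-tabulateFrom lo hi (suc i) K f pos)
  where
  head : (if inside lo hi i then 1 ≤ᵇ f i else true) ≡ true
  head with lo ≤? i | i <? hi
  ... | yes lo≤i | yes i<hi rewrite ≤⇒≤ᵇ≡true lo≤i | <⇒<ᵇ≡true i<hi = ≤⇒≤ᵇ≡true (pos i lo≤i i<hi)
  ... | yes lo≤i | no  i≮hi rewrite ≤⇒≤ᵇ≡true lo≤i | ≮⇒<ᵇ≡false i≮hi = refl
  ... | no  lo≰i | _        rewrite ≰⇒≤ᵇ≡false lo≰i = refl

dominates-tabulateFrom : ∀ i K f g → (∀ j → g j ≤ f j) → dominates (tabulateFrom i K f) (tabulateFrom i K g) ≡ true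
dominates-tabulateFrom i zero    f g g≤f = refl
dominates-tabulateFrom i (suc K) f g g≤f = ∧-intro (≤⇒≤ᵇ≡true (g≤f i)) (dominates-tabulateFrom (suc i) K f g g≤f)

unitSteps-tabulateFrom : ∀ i K f → (∀ j → f j ≤ f (suc j) × f (suc j) ≤ suc (f j)) →
                         unitSteps (tabulateFrom i K f) ≡ true
unitSteps-tabulateFrom i zero    f unit = refl
unitSteps-tabulateFrom i (suc K) f unit = go i K
  where
  go : ∀ i K → unitStepsFrom (f i) (tabulateFrom (suc i) K f) ≡ true
  go i zero    = refl
  go i (suc K) = ∧-intro (≤⇒≤ᵇ≡true (proj₁ (unit i))) (∧-intro (≤⇒≤ᵇ≡true (proj₂ (unit i))) (go (suc i) K))

zipWith-tabulateFrom : ∀ (_⊕_ : ℕ → ℕ → ℕ) i K f g →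
  zipWith _⊕_ (tabulateFrom i K f) (tabulateFrom i K g) ≡ tabulateFrom i K (λ j → f j ⊕ g j)
zipWith-tabulateFrom _⊕_ i zero    f g = refl
zipWith-tabulateFrom _⊕_ i (suc K) f g = cong (_ ∷_) (zipWith-tabulateFrom _⊕_ (suc i) K f g)

NoDip : (ℕ → ℕ) → ℕ → ℕ → Set
NoDip d lo hi = ∀ a b c → lo ≤ a → a < b → b < c → c < hi → ¬ (d b < d a × d b < d c)

noDip-tabulateFrom : ∀ d i K → NoDip d i (i + K) → noDip (tabulateFrom i K d) ≡ true
noDip-tabulateFrom d i zero    no-dip = refl
noDip-tabulateFrom d i (suc K) no-dip =
  go K i false ≤-refl (≤-reflexive (sym (+-suc i K))) (λ ())
  where
  -- while scanning from entry c, "fallen" is justified by an earlier entry a with d c < d a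
  go : ∀ r c fallen → i ≤ c → suc c + r ≤ i + suc K →
       (fallen ≡ true → ∃[ a ] (i ≤ a × a < c × d c < d a)) →
       noDipFrom fallen (d c) (tabulateFrom (suc c) r d) ≡ true
  go zero    c fallen i≤c _     _    = refl
  go (suc r) c fallen i≤c bound fell with d (suc c) <? d c
  ... | yes fall rewrite <⇒<ᵇ≡true fall =
    go r (suc c) true (m≤n⇒m≤1+n i≤c) (subst (_≤ i + suc K) (+-suc (suc c) r) bound) (λ _ → c , i≤c , ≤-refl , fall)
  ... | no no-fall rewrite ≮⇒<ᵇ≡false no-fall with d c <? d (suc c)
  ...   | yes rise rewrite <⇒<ᵇ≡true rise = rising fallen refl fell
    where
    rising : ∀ fallen′ → fallen′ ≡ fallen → (fallen′ ≡ true → ∃[ a ] (i ≤ a × a < c × d c < d a)) →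
             (not fallen′ ∧ noDipFrom fallen′ (d (suc c)) (tabulateFrom (suc (suc c)) r d)) ≡ true
    rising true  _ fell′ with fell′ refl
    ... | a , i≤a , a<c , dip = ⊥-elim (no-dip a c (suc c) i≤a a<c ≤-refl
            (≤-trans (m≤m+n (suc (suc c)) r) (subst (_≤ i + suc K) (+-suc (suc c) r) bound)) (dip , rise))
    rising false _ _ = go r (suc c) false (m≤n⇒m≤1+n i≤c) (subst (_≤ i + suc K) (+-suc (suc c) r) bound) (λ ())
  ...   | no no-rise rewrite ≮⇒<ᵇ≡false no-rise =
    go r (suc c) fallen (m≤n⇒m≤1+n i≤c) (subst (_≤ i + suc K) (+-suc (suc c) r) bound)
       (λ f → let (a , i≤a , a<c , dip) = fell f in a , i≤a , m≤n⇒m≤1+n a<c , subst (_< d a) (sym level) dip)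
    where
    level : d (suc c) ≡ d c
    level = ≤-antisym (≮⇒≥ no-rise) (≮⇒≥ no-fall)

sum-tabulateFrom-mono : ∀ i K {f g} → (∀ j → f j ≤ g j) → sum (tabulateFrom i K f) ≤ sum (tabulateFrom i K g)
sum-tabulateFrom-mono i zero    f≤g = ≤-refl
sum-tabulateFrom-mono i (suc K) f≤g = +-mono-≤ (f≤g i) (sum-tabulateFrom-mono (suc i) K f≤g)

sum-tabulateFrom-< : ∀ i K {f g} → (∀ j → f j ≤ g j) → ∀ j → i ≤ j → j < i + K → f j < g j →
                     sum (tabulateFrom i K f) < sum (tabulateFrom i K g)
sum-tabulateFrom-< i zero    f≤g j i≤j j<i+0 _ = ⊥-elim (<⇒≱ j<i+0 (subst (_≤ j) (sym (+-identityʳ i)) i≤j))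
sum-tabulateFrom-< i (suc K) f≤g j i≤j j<i+1+K fj<gj with i ≟ j
... | yes refl = +-mono-<-≤ fj<gj (sum-tabulateFrom-mono (suc i) K f≤g)
... | no i≢j   = +-mono-≤-< (f≤g i)
  (sum-tabulateFrom-< (suc i) K f≤g j (≤∧≢⇒< i≤j i≢j) (subst (j <_) (+-suc i K) j<i+1+K) fj<gj)

-- the profiles of A₀ = {1,2,3} and A_N = {d+1,d+2,d+3} on a window inside [2, d+2]
startProfile₃ startProfile₂ endProfile₀ endProfile₁ : ℕ → Profile
startProfile₃ K = tabulateFrom 0 K (λ _ → 3)
startProfile₂ K = tabulateFrom 0 K (λ j → if j ≡ᵇ 0 then 2 else 3)
endProfile₀ K = tabulateFrom 0 K (λ _ → 0)
endProfile₁ K = tabulateFrom 0 K (λ j → if j ≡ᵇ K ∸ 1 then 1 else 0)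

NoWalk : Window → Set
NoWalk W = ∀ {start end} →
  start ≡ startProfile₃ (width W) ⊎ start ≡ startProfile₂ (width W) →
  end ≡ endProfile₀ (width W) ⊎ end ≡ endProfile₁ (width W) →
  search W end (suc (sum start)) (start ∷ []) [] ≡ false

five-heavy : NoWalk (window 7 (1 ∷ 2 ∷ 3 ∷ 4 ∷ 5 ∷ []) [])
five-heavy (inj₁ refl) (inj₁ refl) = refl
five-heavy (inj₁ refl) (inj₂ refl) = refl
five-heavy (inj₂ refl) (inj₁ refl) = refl
five-heavy (inj₂ refl) (inj₂ refl) = refl

heavy-light-heavy : NoWalk (window 5 (1 ∷ 3 ∷ []) (2 ∷ []))
heavy-light-heavy (inj₁ refl) (inj₁ refl) = refl
heavy-light-heavy (inj₁ refl) (inj₂ refl) = refl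
heavy-light-heavy (inj₂ refl) (inj₁ refl) = refl
heavy-light-heavy (inj₂ refl) (inj₂ refl) = refl

heavy-light-light-heavy : NoWalk (window 6 (1 ∷ 4 ∷ []) (2 ∷ 3 ∷ []))
heavy-light-light-heavy (inj₁ refl) (inj₁ refl) = refl
heavy-light-light-heavy (inj₁ refl) (inj₂ refl) = refl
heavy-light-light-heavy (inj₂ refl) (inj₁ refl) = refl
heavy-light-light-heavy (inj₂ refl) (inj₂ refl) = refl

-- A path seen through a window is accepted by the search

module WindowTrace {n k : ℕ} (P : MonotoneWSPath n k) (W : Window) (w₀ : ℕ) where
  open Crossings P
  open Weights P

  count : ℕ → ℕ → ℕ
  count t j = card (A P t) (w₀ + j)

  profile : ℕ → Profile
  profile t = tabulateFrom 0 (width W) (count t)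

  shift : Move → Edge
  shift (c , d) = w₀ + c , w₀ + d

  -- the entries j whose interval [w₀ + j, w₀ + j + 1] lies under the edge (p , q), as [lo, hi)
  clip : Edge → Move
  clip (p , q) = p ∸ w₀ , (q ∸ w₀) ⊓ width W

  lo hi : ℕ → ℕ
  lo a = proj₁ (clip (edgeOf a))
  hi a = proj₂ (clip (edgeOf a))

  visible : ℕ → Bool
  visible a = lo a <ᵇ hi a

  hi≤width : ∀ a → hi a ≤ width W
  hi≤width a = m⊓n≤n (x P a ∸ w₀) (width W)

  crosses-window : ∀ a j → j < width W → crosses a (w₀ + j) ≡ inside (lo a) (hi a) j
  crosses-window a j j<width = cong₂ _∧_ (bool-ext below-y above-y) (bool-ext below-x above-x)
    where
    bool-ext : ∀ {b c : Bool} → (b ≡ true → c ≡ true) → (c ≡ true → b ≡ true) → b ≡ c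
    bool-ext {true}  {c}     b⇒c _   = sym (b⇒c refl)
    bool-ext {false} {true}  _   c⇒b = c⇒b refl
    bool-ext {false} {false} _   _   = refl
    below-y : (y P a ≤ᵇ w₀ + j) ≡ true → (lo a ≤ᵇ j) ≡ true
    below-y e = ≤⇒≤ᵇ≡true (subst (lo a ≤_) (m+n∸m≡n w₀ j) (∸-monoˡ-≤ w₀ (≤ᵇ≡true⇒≤ e)))
    above-y : (lo a ≤ᵇ j) ≡ true → (y P a ≤ᵇ w₀ + j) ≡ true
    above-y e = ≤⇒≤ᵇ≡true (≤-trans (m≤n+m∸n (y P a) w₀) (+-monoʳ-≤ w₀ (≤ᵇ≡true⇒≤ e)))
    below-x : (w₀ + j <ᵇ x P a) ≡ true → (j <ᵇ hi a) ≡ true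
    below-x e = <⇒<ᵇ≡true (⊓-glb (subst (_≤ x P a ∸ w₀) (m+n∸m≡n w₀ (suc j))
                                       (∸-monoˡ-≤ w₀ (subst (_≤ x P a) (sym (+-suc w₀ j)) (<ᵇ≡true⇒< e))))
                                  j<width)
    above-x : (j <ᵇ hi a) ≡ true → (w₀ + j <ᵇ x P a) ≡ true
    above-x e with w₀ ≤? x P a | m≤n⊓o⇒m≤n (x P a ∸ w₀) (width W) (<ᵇ≡true⇒< e)
    ... | yes w₀≤x | j<x-w₀ = <⇒<ᵇ≡true (subst (w₀ + j <_) (m+[n∸m]≡n w₀≤x) (+-monoʳ-< w₀ j<x-w₀))
    ... | no w₀≰x  | j<x-w₀ = ⊥-elim (<⇒≱ j<x-w₀ (subst (_≤ j) (sym (m≤n⇒m∸n≡0 (<⇒≤ (≰⇒> w₀≰x)))) z≤n))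

  crosses⇒inside : ∀ a j → j < width W → crosses a (w₀ + j) ≡ true → lo a ≤ j × j < hi a
  crosses⇒inside a j j<width c with trans (sym (crosses-window a j j<width)) c
  ... | e = ≤ᵇ≡true⇒≤ (∧-elimˡ e) , <ᵇ≡true⇒< (∧-elimʳ {lo a ≤ᵇ j} e)

  inside⇒crosses : ∀ a j → j < width W → lo a ≤ j → j < hi a → crosses a (w₀ + j) ≡ true
  inside⇒crosses a j j<width lo≤j j<hi = trans (crosses-window a j j<width) (∧-intro (≤⇒≤ᵇ≡true lo≤j) (<⇒<ᵇ≡true j<hi))

  count-step : ∀ t j → suc t ≤ N P → count t j ≡ count (suc t) j + toℕ (crosses (suc t) (w₀ + j))
  count-step t j 1+t≤N = card-step (suc t) (s≤s z≤n) 1+t≤N (w₀ + j)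

  profile-step : ∀ t → suc t ≤ N P → lowerOn (lo (suc t)) (hi (suc t)) 0 (profile t) ≡ profile (suc t)
  profile-step t 1+t≤N = trans (lowerOn-tabulateFrom _ _ 0 (width W) (count t)) (tabulateFrom-cong 0 (width W) entry)
    where
    entry : ∀ j → 0 ≤ j → j < width W →
            (if inside (lo (suc t)) (hi (suc t)) j then count t j ∸ 1 else count t j) ≡ count (suc t) j
    entry j _ j<width rewrite sym (crosses-window (suc t) j j<width) | count-step t j 1+t≤N
      with crosses (suc t) (w₀ + j)
    ... | true  = m+n∸n≡m _ 1
    ... | false = +-identityʳ _

  profile-invisible : ∀ t → suc t ≤ N P → visible (suc t) ≡ false → profile (suc t) ≡ profile t
  profile-invisible t 1+t≤N invisible = tabulateFrom-cong 0 (width W) entry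
    where
    entry : ∀ j → 0 ≤ j → j < width W → count (suc t) j ≡ count t j
    entry j _ j<width with crosses (suc t) (w₀ + j) in c
    ... | true  = ⊥-elim (true≢false (trans (sym (<⇒<ᵇ≡true (uncurry ≤-<-trans (crosses⇒inside (suc t) j j<width c))))
                                            invisible))
      where
      true≢false : true ≡ false → ⊥
      true≢false ()
    ... | false = sym (trans (count-step t j 1+t≤N) (trans (cong (λ b → count (suc t) j + toℕ b) c) (+-identityʳ _)))

  positive-step : ∀ t → suc t ≤ N P → positiveOn (lo (suc t)) (hi (suc t)) 0 (profile t) ≡ true
  positive-step t 1+t≤N = positiveOn-tabulateFrom _ _ 0 (width W) (count t) pos
    where
    pos : ∀ j → lo (suc t) ≤ j → j < hi (suc t) → 1 ≤ count t j
    pos j lo≤j j<hi rewrite count-step t j 1+t≤N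
                          | inside⇒crosses (suc t) j (<-≤-trans j<hi (hi≤width (suc t))) lo≤j j<hi =
      ≤-trans (s≤s z≤n) (≤-reflexive (+-comm 1 _))

  sum-profile-< : ∀ t → suc t ≤ N P → visible (suc t) ≡ true → sum (profile (suc t)) < sum (profile t)
  sum-profile-< t 1+t≤N vis = sum-tabulateFrom-< 0 (width W) (λ j → card-antitone (w₀ + j) (n≤1+n t) 1+t≤N)
    (lo (suc t)) z≤n (<-≤-trans lo<hi (hi≤width (suc t))) drop
    where
    lo<hi : lo (suc t) < hi (suc t)
    lo<hi = <ᵇ≡true⇒< vis
    drop : count (suc t) (lo (suc t)) < count t (lo (suc t))
    drop rewrite count-step t (lo (suc t)) 1+t≤N
               | inside⇒crosses (suc t) (lo (suc t)) (<-≤-trans lo<hi (hi≤width (suc t))) ≤-refl lo<hi =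
      ≤-reflexive (+-comm 1 _)

  dominates-target : ∀ {target} t → t ≤ N P → profile (N P) ≡ target → dominates (profile t) target ≡ true
  dominates-target t t≤N reaches rewrite sym reaches =
    dominates-tabulateFrom 0 (width W) (count t) (count (N P)) (λ j → card-antitone (w₀ + j) t≤N ≤-refl)

  unitSteps-profile : ∀ t → unitSteps (profile t) ≡ true
  unitSteps-profile t = unitSteps-tabulateFrom 0 (width W) (count t)
    (λ j → subst (λ z → count t j ≤ card (A P t) z × card (A P t) z ≤ suc (count t j)) (sym (+-suc w₀ j))
                 (card-≤-suc (A P t) (w₀ + j)))

  noDip-profiles : ∀ {s t} → s ≤ t → t ≤ N P → noDip (zipWith _∸_ (profile s) (profile t)) ≡ true
  noDip-profiles {s} {t} s≤t t≤N rewrite zipWith-tabulateFrom _∸_ 0 (width W) (count s) (count t) =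
    noDip-tabulateFrom _ 0 (width W)
      (λ a b c _ a<b b<c _ → gap-no-dip s≤t t≤N (+-monoʳ-< w₀ a<b) (+-monoʳ-< w₀ b<c))

  history : ℕ → List Profile
  history zero    = []
  history (suc t) = if visible (suc t) then profile t ∷ history t else history t

  moves : ℕ → List Move
  moves zero    = []
  moves (suc t) = if visible (suc t) then clip (edgeOf (suc t)) ∷ moves t else moves t

  history-profiles : ∀ t → All (λ s → ∃[ t′ ] (t′ ≤ t × s ≡ profile t′)) (history t)
  history-profiles zero    = []
  history-profiles (suc t) with visible (suc t)
  ... | true  = (t , n≤1+n t , refl)
              ∷ All.map (λ { (t′ , t′≤t , e) → t′ , m≤n⇒m≤1+n t′≤t , e }) (history-profiles t)
  ... | false = All.map (λ { (t′ , t′≤t , e) → t′ , m≤n⇒m≤1+n t′≤t , e }) (history-profiles t)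

  moves-steps : ∀ t → All (λ m → ∃[ a ] (1 ≤ a × a ≤ t × m ≡ clip (edgeOf a))) (moves t)
  moves-steps zero    = []
  moves-steps (suc t) with visible (suc t)
  ... | true  = (suc t , s≤s z≤n , ≤-refl , refl)
              ∷ All.map (λ { (a , 1≤a , a≤t , e) → a , 1≤a , m≤n⇒m≤1+n a≤t , e }) (moves-steps t)
  ... | false = All.map (λ { (a , 1≤a , a≤t , e) → a , 1≤a , m≤n⇒m≤1+n a≤t , e }) (moves-steps t)

  history-visible : ∀ {t} → visible (suc t) ≡ true → history (suc t) ≡ profile t ∷ history t
  history-visible v rewrite v = refl

  moves-visible : ∀ {t} → visible (suc t) ≡ true → moves (suc t) ≡ clip (edgeOf (suc t)) ∷ moves t
  moves-visible v rewrite v = refl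

  history-invisible : ∀ {t} → visible (suc t) ≡ false → history (suc t) ≡ history t
  history-invisible v rewrite v = refl

  moves-invisible : ∀ {t} → visible (suc t) ≡ false → moves (suc t) ≡ moves t
  moves-invisible v rewrite v = refl

  used⇒step : ∀ {m t} → used m (moves t) ≡ true → ∃[ a ] (1 ≤ a × a ≤ t × m ≡ clip (edgeOf a))
  used⇒step {m} {t} u = lookup (moves-steps t) (toWitness {a? = m ∈? moves t} (≡true⇒T u))

  clip-shift : ∀ c d → d ≤ width W → clip (shift (c , d)) ≡ (c , d)
  clip-shift c d d≤width = cong₂ _,_ (m+n∸m≡n w₀ c) (trans (cong (_⊓ width W) (m+n∸m≡n w₀ d)) (m≤n⇒m⊓n≡m d≤width))

  shift-clip : ∀ {e c d} → clip e ≡ (c , d) → 1 ≤ c → 1 ≤ d → d < width W → e ≡ shift (c , d)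
  shift-clip {p , q} refl 1≤c 1≤d d<width =
    cong₂ _,_ (sym (m+[n∸m]≡n (<⇒≤ (w₀<z 1≤c))))
              (trans (sym (m+[n∸m]≡n (<⇒≤ (w₀<z (≤-trans 1≤d (m⊓n≤m (q ∸ w₀) (width W)))))))
                     (cong (w₀ +_) (sym unclipped)))
    where
    w₀<z : ∀ {z} → 1 ≤ z ∸ w₀ → w₀ < z
    w₀<z 1≤z-w₀ = m∸n≢0⇒n<m (λ e → <⇒≢ 1≤z-w₀ (sym e))
    unclipped : (q ∸ w₀) ⊓ width W ≡ q ∸ w₀
    unclipped with q ∸ w₀ ≤? width W
    ... | yes fits = m≤n⇒m⊓n≡m fits
    ... | no  wide = ⊥-elim (<-irrefl (m≥n⇒m⊓n≡n (<⇒≤ (≰⇒> wide))) d<width)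

  private
    shifted-short : ∀ {h e c d} → e ≡ shift (c , d) → d ≤ width W → ShortOver h (c , d) →
                    ShortOver h (clip e) × e ≡ shift (clip e)
    shifted-short {h} {c = c} {d} refl d≤width short = subst (ShortOver h) (sym clipped) short , cong shift (sym clipped)
      where clipped = clip-shift c d d≤width

    2+h≤width : ∀ {h} → h + 2 ≤ width W → suc (suc h) ≤ width W
    2+h≤width {h} = subst (_≤ width W) (+-comm h 2)

  clip-short : ∀ {h e} → 1 ≤ h → h + 2 ≤ width W → ShortOver (w₀ + h) e → ShortOver h (clip e) × e ≡ shift (clip e)
  clip-short {h} 1≤h fits (inj₁ (refl , refl)) =
    shifted-short (cong₂ _,_ (+-∸-assoc w₀ 1≤h) (sym (+-suc w₀ h))) (<⇒≤ (2+h≤width fits)) (inj₁ (refl , refl))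
  clip-short {h} 1≤h fits (inj₂ (inj₁ (refl , refl))) =
    shifted-short (cong (w₀ + h ,_) (sym (+-suc w₀ h))) (<⇒≤ (2+h≤width fits)) (inj₂ (inj₁ (refl , refl)))
  clip-short {h} 1≤h fits (inj₂ (inj₂ (refl , refl))) =
    shifted-short (cong (w₀ + h ,_) (trans (cong suc (sym (+-suc w₀ h))) (sym (+-suc w₀ (suc h)))))
                  (2+h≤width fits) (inj₂ (inj₂ (refl , refl)))

  HeavyEntries : Set
  HeavyEntries = All (λ h → 1 ≤ h × h + 2 ≤ width W × HeavyShape (w₀ + h)) (heavyOffsets W)

  LightEntries : Set
  LightEntries = All (λ h → 2 ≤ h × h + 3 ≤ width W × NoShortTriple (w₀ + h)) (lightOffsets W)

  -- Two steps with the same move over a heavy entry carry the same short edge, hence coincide.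
  heavyOK-step : ∀ t → suc t ≤ N P → HeavyEntries → heavyOK (heavyOffsets W) (clip (edgeOf (suc t))) (moves t) ≡ true
  heavyOK-step t 1+t≤N entries = T⇒≡true (all⁻ _ (All.map (≡true⇒T ∘ entry) entries))
    where
    a = suc t
    entry : ∀ {h} → 1 ≤ h × h + 2 ≤ width W × HeavyShape (w₀ + h) →
            (if inside (lo a) (hi a) h then ⌊ shortOver? h (clip (edgeOf a)) ⌋ ∧ not (used (clip (edgeOf a)) (moves t))
             else true) ≡ true
    entry {h} (1≤h , fits , shape) with inside (lo a) (hi a) h in over
    ... | false = refl
    ... | true  = ∧-intro (T⇒≡true (fromWitness (proj₁ (clip-short 1≤h fits (short a (s≤s z≤n) 1+t≤N crossing)))))
                          (fresh (used (clip (edgeOf a)) (moves t)) refl)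
      where
      open HeavyShape shape
      h<width : h < width W
      h<width = <-≤-trans (<ᵇ≡true⇒< (∧-elimʳ {lo a ≤ᵇ h} over)) (hi≤width a)
      crossing : crosses a (w₀ + h) ≡ true
      crossing = trans (crosses-window a h h<width) over
      fresh : ∀ b → used (clip (edgeOf a)) (moves t) ≡ b → not b ≡ true
      fresh false _ = refl
      fresh true  u with used⇒step u
      ... | a′ , 1≤a′ , a′≤t , same = ⊥-elim (1+n≰n (subst (_≤ t) (sym a≡a′) a′≤t))
        where
        a′≤N = ≤-trans a′≤t (<⇒≤ 1+t≤N)
        crossing′ : crosses a′ (w₀ + h) ≡ true
        crossing′ = trans (crosses-window a′ h h<width) (subst (λ m → inside (proj₁ m) (proj₂ m) h ≡ true) same over)
        a≡a′ : a ≡ a′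
        a≡a′ = distinct a a′ (s≤s z≤n) 1+t≤N 1≤a′ a′≤N crossing crossing′ (begin
          edgeOf a               ≡⟨ proj₂ (clip-short 1≤h fits (short a (s≤s z≤n) 1+t≤N crossing)) ⟩
          shift (clip (edgeOf a))  ≡⟨ cong shift same ⟩
          shift (clip (edgeOf a′)) ≡⟨ proj₂ (clip-short 1≤h fits (short a′ 1≤a′ a′≤N crossing′)) ⟨
          edgeOf a′              ∎)
          where open ≡-Reasoning

  lightOK-final : LightEntries → lightOK (lightOffsets W) (moves (N P)) ≡ true
  lightOK-final entries = T⇒≡true (all⁻ _ (All.map (≡true⇒T ∘ entry) entries))
    where
    ms = moves (N P)
    edge : ∀ {c d} → used (c , d) ms ≡ true → 1 ≤ c → 1 ≤ d → d < width W → isEdge P (w₀ + c) (w₀ + d) ≡ true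
    edge u 1≤c 1≤d d<width with used⇒step u
    ... | a , 1≤a , a≤N , same =
      subst (λ e → isEdge P (proj₁ e) (proj₂ e) ≡ true) (shift-clip (sym same) 1≤c 1≤d d<width) (step⇒isEdge a 1≤a a≤N)
    entry : ∀ {h} → 2 ≤ h × h + 3 ≤ width W × NoShortTriple (w₀ + h) →
            not (used (h ∸ 1 , suc h) ms ∧ used (h , suc h) ms ∧ used (h , suc (suc h)) ms) ≡ true
    entry {suc g} (s≤s 1≤g , fits , none)
      with used (g , suc (suc g)) ms in u₁ | used (suc g , suc (suc g)) ms in u₂ | used (suc g , suc (suc (suc g))) ms in u₃
    ... | false | _     | _     = refl
    ... | true  | false | _     = refl
    ... | true  | true  | false = refl
    ... | true  | true  | true  = ⊥-elim (none
      ( subst₂ (λ p q → isEdge P p q ≡ true) (sym (+-∸-assoc w₀ (s≤s z≤n))) (+-suc w₀ (suc g))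
               (edge u₁ 1≤g (s≤s z≤n) (<⇒≤ 4+g≤width))
      , subst (λ q → isEdge P (w₀ + suc g) q ≡ true) (+-suc w₀ (suc g)) (edge u₂ (s≤s z≤n) (s≤s z≤n) (<⇒≤ 4+g≤width))
      , subst (λ q → isEdge P (w₀ + suc g) q ≡ true) (trans (+-suc w₀ (suc (suc g))) (cong suc (+-suc w₀ (suc g))))
              (edge u₃ (s≤s z≤n) (s≤s z≤n) 4+g≤width)))
      where
      4+g≤width : suc (suc (suc (suc g))) ≤ width W
      4+g≤width = subst (_≤ width W) (+-comm (suc g) 3) fits

  admissible-step : ∀ {target} t → suc t ≤ N P → profile (N P) ≡ target → HeavyEntries →
    admissible W target (profile (suc t)) (profile t ∷ history t) (clip (edgeOf (suc t))) (moves t) ≡ true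
  admissible-step t 1+t≤N reaches heavies = ∧-intro (dominates-target (suc t) 1+t≤N reaches)
    (∧-intro (unitSteps-profile (suc t))
      (∧-intro (heavyOK-step t 1+t≤N heavies) (T⇒≡true (all⁻ (λ s → noDip (zipWith _∸_ s (profile (suc t)))) no-dips))))
    where
    no-dips : All (λ s → T (noDip (zipWith _∸_ s (profile (suc t))))) (profile t ∷ history t)
    no-dips = ≡true⇒T (noDip-profiles (n≤1+n t) 1+t≤N)
            ∷ All.map (λ { (t′ , t′≤t , refl) → ≡true⇒T (noDip-profiles (m≤n⇒m≤1+n t′≤t) 1+t≤N) }) (history-profiles t)

  private
    step-before-end : ∀ {t r} → t + suc r ≡ N P → suc t ≤ N P
    step-before-end {t} {r} e = subst (suc t ≤_) e (subst (suc t ≤_) (sym (+-suc t r)) (s≤s (m≤m+n t r)))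

  -- Every visible step lowers the profile sum, so the remaining fuel only has to cover the
  -- decrease still to come.
  search-follows-path : ∀ {target} → profile (N P) ≡ target → HeavyEntries → LightEntries →
    ∀ r t → t + r ≡ N P → ∀ f → sum (profile t) ∸ sum target ≤ f →
    search W target (suc f) (profile t ∷ history t) (moves t) ≡ true
  search-follows-path {target} reaches heavies lights zero t t+0≡N f _ with trans (sym (+-identityʳ t)) t+0≡N
  ... | refl = ∨-introˡ (∧-intro (T⇒≡true (fromWitness {a? = List.≡-dec _≟_ (profile (N P)) target} reaches))
                                 (lightOK-final lights))
  search-follows-path {target} reaches heavies lights (suc r) t t+1+r≡N f budget with visible (suc t) in vis
  ... | false = subst (λ s → search W target (suc f) (s ∷ history t) (moves t) ≡ true) same
      (subst₂ (λ hs ms → search W target (suc f) (profile (suc t) ∷ hs) ms ≡ true)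
              (history-invisible vis) (moves-invisible vis)
              (search-follows-path reaches heavies lights r (suc t) (trans (sym (+-suc t r)) t+1+r≡N) f
                                   (subst (λ s → sum s ∸ sum target ≤ f) (sym same) budget)))
    where
    1+t≤N = step-before-end t+1+r≡N
    same : profile (suc t) ≡ profile t
    same = profile-invisible t 1+t≤N vis
  ... | true  = ∨-introʳ (any-range⁺ _ (λ i → i) (width W) (lo a) lo<width
                  (any-from⁺ _ (suc (lo a)) (width W ∸ lo a) (hi a) lo<hi hi-bound step))
    where
    a = suc t
    1+t≤N = step-before-end t+1+r≡N
    lo<hi : lo a < hi a
    lo<hi = <ᵇ≡true⇒< vis
    lo<width : lo a < width W
    lo<width = <-≤-trans lo<hi (hi≤width a)
    hi-bound : hi a < suc (lo a) + (width W ∸ lo a)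
    hi-bound = s≤s (≤-trans (hi≤width a) (≤-reflexive (sym (m+[n∸m]≡n (<⇒≤ lo<width)))))
    left : sum (profile a) ∸ sum target < sum (profile t) ∸ sum target
    left = ∸-monoˡ-< (sum-profile-< t 1+t≤N vis)
                     (subst (λ s → sum s ≤ sum (profile a)) reaches
                            (sum-tabulateFrom-mono 0 (width W) (λ j → card-antitone (w₀ + j) 1+t≤N ≤-refl)))
    continue : ∀ f → sum (profile t) ∸ sum target ≤ f →
               search W target f (profile a ∷ profile t ∷ history t) (clip (edgeOf a) ∷ moves t) ≡ true
    continue zero    budget′ = ⊥-elim (<⇒≱ (<-≤-trans left budget′) z≤n)
    continue (suc f) budget′ = subst₂ (λ hs ms → search W target (suc f) (profile a ∷ hs) ms ≡ true)
      (history-visible vis) (moves-visible vis)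
      (search-follows-path reaches heavies lights r a (trans (sym (+-suc t r)) t+1+r≡N) f (≤-pred (<-≤-trans left budget′)))
    step : (positiveOn (lo a) (hi a) 0 (profile t) ∧
            (admissible W target (lowerOn (lo a) (hi a) 0 (profile t)) (profile t ∷ history t) (lo a , hi a) (moves t) ∧
             search W target f (lowerOn (lo a) (hi a) 0 (profile t) ∷ profile t ∷ history t) ((lo a , hi a) ∷ moves t))) ≡ true
    step = ∧-intro (positive-step t 1+t≤N)
      (subst (λ s → (admissible W target s (profile t ∷ history t) (clip (edgeOf a)) (moves t)
                     ∧ search W target f (s ∷ profile t ∷ history t) (clip (edgeOf a) ∷ moves t)) ≡ true)
             (sym (profile-step t 1+t≤N)) (∧-intro (admissible-step t 1+t≤N reaches heavies) (continue f budget)))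

  search-accepts : ∀ {target} → profile (N P) ≡ target → HeavyEntries → LightEntries →
                   search W target (suc (sum (profile 0))) (profile 0 ∷ []) [] ≡ true
  search-accepts {target} reaches heavies lights =
    search-follows-path reaches heavies lights (N P) 0 refl (sum (profile 0)) (m∸n≤m (sum (profile 0)) (sum target))

-- Forbidden configurations of heavy and light intervals

module Configurations (d : ℕ) (3≤d : 3 ≤ d) (P : MonotoneWSPath (3 + d) 3)
                      (start : ∀ z → A P 0 z ≡ ⟦ 1 , 2 , 3 ⟧ z) (end : ∀ z → A P (N P) z ≡ lastThree d z) where

  open Crossings P
  open Weights P
  open HeavyIntervals d 3≤d P start end public

  HeavyAt LightAt : ℕ → Set
  HeavyAt v = wtlim (3 + d) v <ℚ wt P v
  LightAt v = wt P v ≤ℚ wtlim (3 + d) v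

  light⇒NoShortTriple : ∀ v → 2 ≤ v → v + 2 ≤ 3 + d → LightAt v → NoShortTriple v
  light⇒NoShortTriple v 2≤v fits light (e₁ , e₂ , e₃) =
    <⇒≱ℚ (short-triple⇒11/6<wt v 2≤v fits e₁ e₂ e₃) (ℚ.≤-trans light (wtlim≤11/6 (3 + d) v))

  private
    count-end : ∀ w₀ j → w₀ + j ≤ d → card (A P (N P)) (w₀ + j) ≡ 0
    count-end w₀ j ≤d = trans (card-cong end (w₀ + j)) (card-lastThree-≤ d (w₀ + j) ≤d)

  start-profile : ∀ W w₀ → 2 ≤ w₀ →
    WindowTrace.profile P W w₀ 0 ≡ startProfile₃ (width W) ⊎ WindowTrace.profile P W w₀ 0 ≡ startProfile₂ (width W)
  start-profile W w₀ 2≤w₀ with m≤n⇒m<n∨m≡n 2≤w₀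
  ... | inj₁ 3≤w₀ = inj₁ (tabulateFrom-cong 0 (width W) (λ j _ _ → count₀ j (≤-trans 3≤w₀ (m≤m+n w₀ j))))
    where
    count₀ : ∀ j → 3 ≤ w₀ + j → card (A P 0) (w₀ + j) ≡ 3
    count₀ j 3≤ = trans (card-cong start (w₀ + j)) (card-⟦1,2,3⟧ 3≤)
  ... | inj₂ refl = inj₂ (tabulateFrom-cong 0 (width W) entry)
    where
    entry : ∀ j → 0 ≤ j → j < width W → card (A P 0) (2 + j) ≡ (if j ≡ᵇ 0 then 2 else 3)
    entry zero    _ _ = card-cong start 2
    entry (suc j) _ _ = trans (card-cong start (3 + j)) (card-⟦1,2,3⟧ {3 + j} (s≤s (s≤s (s≤s z≤n))))

  end-profile : ∀ W w₀ → w₀ + width W ≤ 2 + d →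
    WindowTrace.profile P W w₀ (N P) ≡ endProfile₀ (width W) ⊎ WindowTrace.profile P W w₀ (N P) ≡ endProfile₁ (width W)
  end-profile W w₀ fits with m≤n⇒m<n∨m≡n fits
  ... | inj₁ short = inj₁ (tabulateFrom-cong 0 (width W)
          (λ j _ j<W → count-end w₀ j (≤-pred (≤-trans (+-monoʳ-< w₀ j<W) (≤-pred short)))))
  ... | inj₂ flush = inj₂ (tabulateFrom-cong 0 (width W) entry)
    where
    entry : ∀ j → 0 ≤ j → j < width W → card (A P (N P)) (w₀ + j) ≡ (if j ≡ᵇ width W ∸ 1 then 1 else 0)
    entry j _ j<W with j ≟ width W ∸ 1
    ... | yes j≡W-1 rewrite ≡⇒≡ᵇ≡true j≡W-1 =
      trans (card-cong end (w₀ + j)) (subst (λ z → card (lastThree d) z ≡ 1) (sym last) (card-lastThree-1+m d))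
      where
      last : w₀ + j ≡ suc d
      last = suc-injective (trans (sym (+-suc w₀ j))
               (trans (cong (w₀ +_) (trans (cong suc j≡W-1) (m+[n∸m]≡n {1} (≤-trans (s≤s z≤n) j<W)))) flush))
    ... | no j≢W-1 rewrite ≢⇒≡ᵇ≡false j≢W-1 =
      count-end w₀ j (≤-pred (≤-pred (subst₂ _<_ (+-suc w₀ j) flush (+-monoʳ-< w₀ (≤∧≢⇒< j<W (j≢W-1 ∘ cong (_∸ 1)))))))

  no-window : ∀ W → NoWalk W → ∀ w₀ → 2 ≤ w₀ → w₀ + width W ≤ 2 + d →
    All (λ h → 1 ≤ h × h + 2 ≤ width W × HeavyAt (h + w₀)) (heavyOffsets W) →
    All (λ h → 2 ≤ h × h + 3 ≤ width W × LightAt (h + w₀)) (lightOffsets W) → ⊥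
  no-window W no-walk w₀ 2≤w₀ fits heavies lights =
    true≢false (trans (sym accepted) (no-walk (start-profile W w₀ 2≤w₀) (end-profile W w₀ fits)))
    where
    open WindowTrace P W w₀
    true≢false : true ≡ false → ⊥
    true≢false ()
    accepted : search W (profile (N P)) (suc (sum (profile 0))) (profile 0 ∷ []) [] ≡ true
    accepted = search-accepts refl
      (All.map (λ { {h} (1≤h , h+2≤W , heavy) →
                    1≤h , h+2≤W , proj₂ (proj₂ (heavy-interval (w₀ + h) (subst HeavyAt (+-comm h w₀) heavy))) }) heavies)
      (All.map (λ { {h} (2≤h , h+3≤W , light) →
                    2≤h , h+3≤W , light⇒NoShortTriple (w₀ + h) (≤-trans 2≤h (m≤n+m h w₀)) (inside-bound h+3≤W)
                                                      (subst LightAt (+-comm h w₀) light) }) lights)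
      where
      inside-bound : ∀ {h} → h + 3 ≤ width W → w₀ + h + 2 ≤ 3 + d
      inside-bound {h} h+3≤W = ≤-trans (≤-reflexive (+-assoc w₀ h 2))
        (≤-trans (+-monoʳ-≤ w₀ (≤-trans (+-monoʳ-≤ h (n≤1+n 2)) h+3≤W)) (≤-trans fits (n≤1+n _)))

  3≤heavy : ∀ {v} → HeavyAt v → 3 ≤ v
  3≤heavy {v} heavy = proj₁ (heavy-interval v heavy)

  heavy≤d : ∀ {v} → HeavyAt v → v ≤ d
  heavy≤d {v} heavy = proj₁ (proj₂ (heavy-interval v heavy))

  private
    heavy-entry : ∀ {W h w₀} → T ((1 ≤ᵇ h) ∧ (h + 2 ≤ᵇ W)) → HeavyAt (h + w₀) → 1 ≤ h × h + 2 ≤ W × HeavyAt (h + w₀)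
    heavy-entry {W} {h} fits heavy with Equivalence.to T-∧ fits
    ... | 1≤h , h+2≤W = ≤ᵇ⇒≤ 1 h 1≤h , ≤ᵇ⇒≤ (h + 2) W h+2≤W , heavy

    light-entry : ∀ {W h w₀} → T ((2 ≤ᵇ h) ∧ (h + 3 ≤ᵇ W)) → LightAt (h + w₀) → 2 ≤ h × h + 3 ≤ W × LightAt (h + w₀)
    light-entry {W} {h} fits light with Equivalence.to T-∧ fits
    ... | 2≤h , h+3≤W = ≤ᵇ⇒≤ 2 h 2≤h , ≤ᵇ⇒≤ (h + 3) W h+3≤W , light

  no-five-heavy : ∀ {v} → HeavyAt v → HeavyAt (1 + v) → HeavyAt (2 + v) → HeavyAt (3 + v) → HeavyAt (4 + v) → ⊥
  no-five-heavy {zero}     h₀ _  _  _  _  = 1+n≰n (≤-trans (3≤heavy h₀) z≤n)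
  no-five-heavy {suc w₀} h₀ h₁ h₂ h₃ h₄ = no-window (window 7 (1 ∷ 2 ∷ 3 ∷ 4 ∷ 5 ∷ []) []) five-heavy w₀
    (≤-pred (3≤heavy h₀)) (subst (_≤ 2 + d) (+-comm 7 w₀) (s≤s (s≤s (heavy≤d h₄))))
    (heavy-entry _ h₀ ∷ heavy-entry _ h₁ ∷ heavy-entry _ h₂ ∷ heavy-entry _ h₃ ∷ heavy-entry _ h₄ ∷ []) []

  no-heavy-light-heavy : ∀ {v} → HeavyAt v → LightAt (1 + v) → HeavyAt (2 + v) → ⊥
  no-heavy-light-heavy {zero}   h₀ _  _  = 1+n≰n (≤-trans (3≤heavy h₀) z≤n)
  no-heavy-light-heavy {suc w₀} h₀ l₁ h₂ = no-window (window 5 (1 ∷ 3 ∷ []) (2 ∷ [])) heavy-light-heavy w₀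
    (≤-pred (3≤heavy h₀)) (subst (_≤ 2 + d) (+-comm 5 w₀) (s≤s (s≤s (heavy≤d h₂))))
    (heavy-entry _ h₀ ∷ heavy-entry _ h₂ ∷ []) (light-entry _ l₁ ∷ [])

  no-heavy-light-light-heavy : ∀ {v} → HeavyAt v → LightAt (1 + v) → LightAt (2 + v) → HeavyAt (3 + v) → ⊥
  no-heavy-light-light-heavy {zero}   h₀ _  _  _  = 1+n≰n (≤-trans (3≤heavy h₀) z≤n)
  no-heavy-light-light-heavy {suc w₀} h₀ l₁ l₂ h₃ = no-window (window 6 (1 ∷ 4 ∷ []) (2 ∷ 3 ∷ [])) heavy-light-light-heavy w₀
    (≤-pred (3≤heavy h₀)) (subst (_≤ 2 + d) (+-comm 6 w₀) (s≤s (s≤s (heavy≤d h₃))))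
    (heavy-entry _ h₀ ∷ heavy-entry _ h₃ ∷ []) (light-entry _ l₁ ∷ light-entry _ l₂ ∷ [])

-- The decomposition into light blocks L₀, …, L_m and heavy blocks H₁, …, H_m

module Blocks (d : ℕ) (3≤d : 3 ≤ d) (P : MonotoneWSPath (3 + d) 3)
  (start : ∀ z → A P 0 z ≡ ⟦ 1 , 2 , 3 ⟧ z) (end : ∀ z → A P (N P) z ≡ lastThree d z)
  (m : ℕ) (ℓ h : ℕ → ℕ)
  (chain : ∀ i → i ≤ m → Lstart m h i < Lend (3 + d) m ℓ i)
  (nonempty : ∀ i → 1 ≤ i → i ≤ m → ℓ (i ∸ 1) < h i)
  (light : ∀ i j → i ≤ m → Lstart m h i ≤ j → j + 1 ≤ Lend (3 + d) m ℓ i → wt P j ≤ℚ wtlim (3 + d) j)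
  (heavy : ∀ i j → 1 ≤ i → i ≤ m → ℓ (i ∸ 1) ≤ j → j + 1 ≤ h i → wtlim (3 + d) j <ℚ wt P j) where

  open Configurations d 3≤d P start end

  heavy-unit : ∀ i → 1 ≤ i → i ≤ m → ∀ o → o + ℓ (i ∸ 1) < h i → HeavyAt (o + ℓ (i ∸ 1))
  heavy-unit i 1≤i i≤m o fits = heavy i (o + ℓ (i ∸ 1)) 1≤i i≤m (m≤n+m _ o) (subst (_≤ h i) (+-comm 1 _) fits)

  last-heavy-unit : ∀ i → 1 ≤ i → i ≤ m → ∃[ v ] (suc v ≡ h i × HeavyAt v)
  last-heavy-unit i 1≤i i≤m with m≤n⇒∃[o]m+o≡n (nonempty i 1≤i i≤m)
  ... | o , 1+ℓ+o≡h = o + ℓ (i ∸ 1) , v≡ , heavy-unit i 1≤i i≤m o (≤-reflexive v≡)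
    where v≡ = trans (cong suc (+-comm o (ℓ (i ∸ 1)))) 1+ℓ+o≡h

  L₀-long : 2 ≤ Lend (3 + d) m ℓ 0 ∸ 1
  L₀-long with 0 ≟ m
  ... | yes 0≡m rewrite ≡⇒≡ᵇ≡true 0≡m = s≤s (s≤s z≤n)
  ... | no  0≢m rewrite ≢⇒≡ᵇ≡false 0≢m = ∸-monoˡ-≤ 1 (3≤heavy (heavy-unit 1 ≤-refl 1≤m 0 (nonempty 1 ≤-refl 1≤m)))
    where 1≤m = ≤∧≢⇒< z≤n 0≢m

  Lₘ-long : 2 ≤ (3 + d) ∸ Lstart m h m
  Lₘ-long = at m refl
    where
    at : ∀ i → i ≡ m → 2 ≤ (3 + d) ∸ Lstart m h i
    at zero    _     = s≤s (s≤s z≤n)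
    at (suc k) 1+k≡m with last-heavy-unit (suc k) (s≤s z≤n) (≤-reflexive 1+k≡m)
    ... | v , 1+v≡h , heavy-v = subst (λ z → 2 ≤ 3 + d ∸ z) 1+v≡h
            (≤-trans (≤-reflexive (sym (m+n∸n≡m 2 d))) (∸-monoʳ-≤ (3 + d) (s≤s (heavy≤d heavy-v))))

  -- A light block between two heavy ones of length 1 or 2 gives H L H or H L L H.
  inner-L-long : ∀ i → 1 ≤ i → i + 1 ≤ m → 3 ≤ ℓ i ∸ h i
  inner-L-long i@(suc _) 1≤i i+1≤m = by-gap (last-heavy-unit i 1≤i i≤m) (ℓ i ∸ h i) refl
    where
    i<m : suc i ≤ m
    i<m = subst (_≤ m) (+-comm i 1) i+1≤m
    i≤m : i ≤ m
    i≤m = <⇒≤ i<m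
    Lend≡ℓ : Lend (3 + d) m ℓ i ≡ ℓ i
    Lend≡ℓ rewrite ≢⇒≡ᵇ≡false (<⇒≢ i<m) = refl
    h<ℓ : h i < ℓ i
    h<ℓ = subst (h i <_) Lend≡ℓ (chain i i≤m)
    light-unit : ∀ j → h i ≤ j → j + 1 ≤ ℓ i → LightAt j
    light-unit j h≤j j+1≤ℓ = light i j i≤m h≤j (subst (j + 1 ≤_) (sym Lend≡ℓ) j+1≤ℓ)
    heavy-ℓ : HeavyAt (ℓ i)
    heavy-ℓ = heavy-unit (suc i) (s≤s z≤n) i<m 0 (nonempty (suc i) (s≤s z≤n) i<m)
    ℓ≡h+ : ∀ {g} → ℓ i ∸ h i ≡ g → ℓ i ≡ g + h i
    ℓ≡h+ {g} gap = trans (sym (m+[n∸m]≡n (<⇒≤ h<ℓ))) (trans (cong (h i +_) gap) (+-comm (h i) g))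
    by-gap : ∃[ v ] (suc v ≡ h i × HeavyAt v) → ∀ g → ℓ i ∸ h i ≡ g → 3 ≤ ℓ i ∸ h i
    by-gap _ zero gap = ⊥-elim (<⇒≢ (m<n⇒0<n∸m h<ℓ) (sym gap))
    by-gap (v , 1+v≡h , heavy-v) 1 gap = ⊥-elim (no-heavy-light-heavy heavy-v
      (subst LightAt (sym 1+v≡h) (light-unit (h i) ≤-refl (≤-reflexive (trans (+-comm (h i) 1) (sym (ℓ≡h+ gap))))))
      (subst HeavyAt (trans (ℓ≡h+ gap) (cong suc (sym 1+v≡h))) heavy-ℓ))
    by-gap (v , 1+v≡h , heavy-v) 2 gap = ⊥-elim (no-heavy-light-light-heavy heavy-v
      (subst LightAt (sym 1+v≡h) (light-unit (h i) ≤-refl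
        (≤-trans (≤-reflexive (+-comm (h i) 1)) (subst (suc (h i) ≤_) (sym (ℓ≡h+ gap)) (n≤1+n _)))))
      (subst LightAt (cong suc (sym 1+v≡h)) (light-unit (suc (h i)) (n≤1+n _)
        (≤-reflexive (trans (+-comm (suc (h i)) 1) (sym (ℓ≡h+ gap))))))
      (subst HeavyAt (trans (ℓ≡h+ gap) (cong (λ z → suc (suc z)) (sym 1+v≡h))) heavy-ℓ))
    by-gap _ (suc (suc (suc _))) gap = subst (3 ≤_) (sym gap) (s≤s (s≤s (s≤s z≤n)))

  H-short : ∀ i → 1 ≤ i → i ≤ m → h i ∸ ℓ (i ∸ 1) ≤ 4
  H-short i 1≤i i≤m with h i ∸ ℓ (i ∸ 1) ≤? 4
  ... | yes short = short
  ... | no  long  = ⊥-elim (no-five-heavy (unit 0 _) (unit 1 _) (unit 2 _) (unit 3 _) (unit 4 _))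
    where
    5+ℓ≤h : 5 + ℓ (i ∸ 1) ≤ h i
    5+ℓ≤h = ≤-trans (+-monoˡ-≤ (ℓ (i ∸ 1)) (≰⇒> long)) (≤-reflexive (m∸n+n≡m (<⇒≤ (nonempty i 1≤i i≤m))))
    unit : ∀ o → T (suc o ≤ᵇ 5) → HeavyAt (o + ℓ (i ∸ 1))
    unit o o<5 = heavy-unit i 1≤i i≤m o (≤-trans (+-monoˡ-≤ (ℓ (i ∸ 1)) (≤ᵇ⇒≤ (suc o) 5 o<5)) 5+ℓ≤h)

proposition3p21 : (n : ℕ) → 6 ≤ n →
    (P : MonotoneWSPath n 3) →
    (∀ z → A P 0 z ≡ ⟦ 1 , 2 , 3 ⟧ z) →
    (∀ z → A P (N P) z ≡ ⟦ n ∸ 2 , n ∸ 1 , n ⟧ z) →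
    (m : ℕ) (ℓ h : ℕ → ℕ) →
    (∀ i → i ≤ m → Lstart m h i < Lend n m ℓ i) →
    (∀ i → 1 ≤ i → i ≤ m → ℓ (i ∸ 1) < h i) →
    (∀ i j → i ≤ m → Lstart m h i ≤ j → j + 1 ≤ Lend n m ℓ i →
       wt P j ≤ℚ wtlim n j) →
    (∀ i j → 1 ≤ i → i ≤ m → ℓ (i ∸ 1) ≤ j → j + 1 ≤ h i →
       wtlim n j <ℚ wt P j) →
    (2 ≤ Lend n m ℓ 0 ∸ 1)
    × (2 ≤ n ∸ Lstart m h m)
    × (∀ i → 1 ≤ i → i + 1 ≤ m → 3 ≤ ℓ i ∸ h i)
    × (∀ i → 1 ≤ i → i ≤ m → h i ∸ ℓ (i ∸ 1) ≤ 4)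
proposition3p21 (suc (suc (suc d))) (s≤s (s≤s (s≤s 3≤d))) P start end m ℓ h chain nonempty light heavy =
  L₀-long , Lₘ-long , inner-L-long , H-short
  where open Blocks d 3≤d P start end m ℓ h chain nonempty light heavy
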